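{- For every $n\geq 0$ the nine maps $\lambda,\rho\colon\mathfrak{S}_n\to\mathcal{Y}_n$, $\gamma\colon\mathcal{Y}_n\to\mathfrak{S}_n$, $L,R\colon\mathcal{Y}_n\to\mathcal{Q}_n$, $C\colon\mathcal{Q}_n\to\mathcal{Y}_n$, $\mathrm{Des},\mathrm{GDes}\colon\mathfrak{S}_n\to\mathcal{Q}_n$, $Z\colon\mathcal{Q}_n\to\mathfrak{S}_n$ are order-preserving, and $$L\circ\lambda=\mathrm{Des},\qquad \gamma\circ C=Z,\qquad R\circ\rho=\mathrm{GDes}.$$ Moreover, for all $\sigma\in\mathfrak{S}_n$, $t\in\mathcal{Y}_n$ and $\mathsf{S}\in\mathcal{Q}_n$: $$\lambda(\sigma)\leq t\iff \sigma\leq\gamma(t),\qquad L(t)\subseteq \mathsf{S}\iff t\leq C(\mathsf{S}),\qquad \mathrm{Des}(\sigma)\subseteq\mathsf{S}\iff \sigma\leq Z(\mathsf{S}),$$ $$\gamma(t)\leq\sigma\iff t\leq\rho(\sigma),\qquad C(\mathsf{S})\leq t\iff \mathsf{S}\subseteq R(t),\qquad Z(\mathsf{S})\leq\sigma\iff \mathsf{S}\subseteq\mathrm{GDes}(\sigma).$$ That is, $(\lambda,\gamma)$, $(L,C)$, $(\mathrm{Des},Z)$, $(\gamma,\rho)$, $(C,R)$, $(Z,\mathrm{GDes})$ are Galois connections.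
   Context: Permutations: $\mathfrak{S}_n$ is the set of permutations of $[n]=\{1,\dots,n\}$ in one-line notation; $\mathfrak{S}_0=\{\mathrm{id}_0\}$. For distinct integers $a_1,\dots,a_p$, $\mathrm{st}(a_1,\dots,a_p)\in\mathfrak{S}_p$ is the unique permutation with $\sigma(i)<\sigma(j)\iff a_i<a_j$. $\mathrm{Inv}(\sigma)=\{(i,j):i<j,\ \sigma(i)>\sigma(j)\}$; the weak order on $\mathfrak{S}_n$ is $\sigma\leq\tau\iff\mathrm{Inv}(\sigma)\subseteq\mathrm{Inv}(\tau)$. $\mathrm{Des}(\sigma)=\{p\in[n-1]:\sigma(p)>\sigma(p+1)\}$. For $\sigma\in\mathfrak{S}_p,\tau\in\mathfrak{S}_q$: $\sigma\vee\tau\in\mathfrak{S}_{p+q+1}$ has values $\sigma(1)+q,\dots,\sigma(p)+q,\ p+q+1,\ \tau(1),\dots,\tau(q)$; $\sigma\backslash\tau\in\mathfrak{S}_{p+q}$ has values $\sigma(1)+q,\dots,\sigma(p)+q,\tau(1),\dots,\tau(q)$. $\mathrm{GDes}(\sigma)=\{p\in[n-1]:\sigma=\alpha\backslash\beta\text{ for some }\alpha\in\mathfrak{S}_p\}$ (global descents). $\mathcal{Q}_n$ is the poset of subsets of $[n-1]$ under inclusion. Trees: $\mathcal{Y}_n$ is the set of rooted planar binary trees with $n$ internal nodes ($n+1$ leaves); $\mathcal{Y}_0=\{|\}$. Every $t\in\mathcal{Y}_n$, $n\geq1$, is uniquely $t=t_l\vee t_r$ (grafting $t_l$ and $t_r$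 onto the left and right leaves of the tree with one internal node). The Tamari order on $\mathcal{Y}_n$ is the partial order generated by replacing a subtree of the form $(A\vee B)\vee C$ by $A\vee(B\vee C)$. Define $1_0=|$, $1_n=1_{n-1}\vee|$. Define recursively $|\backslash t=t$ and $s\backslash t=s_l\vee(s_r\backslash t)$. Maps: $\lambda(\mathrm{id}_0)=|$; for $\sigma\in\mathfrak{S}_n$, $n\geq1$, with $j=\sigma^{ -1}(n)$, $\lambda(\sigma)=\lambda(\mathrm{st}(\sigma(1),\dots,\sigma(j-1)))\vee\lambda(\mathrm{st}(\sigma(j+1),\dots,\sigma(n)))$. $\gamma(|)=\mathrm{id}_0$, $\gamma(t)=\gamma(t_l)\vee\gamma(t_r)$. $\rho(\mathrm{id}_0)=|$; for $\sigma\in\mathfrak{S}_n$, $n\geq1$, let $j$ be the smallest element of $\mathrm{GDes}(\sigma)$ if this set is nonempty and $j=n$ otherwise, and set $\rho(\sigma)=\rho(\mathrm{st}(\sigma(1),\dots,\sigma(j-1)))\vee\rho(\mathrm{st}(\sigma(j+1),\dots,\sigma(n)))$. For $\mathsf{S}=\{p_1<\dots<p_k\}\in\mathcal{Q}_n$: $Z(\mathsf{S})=\mathrm{id}_{p_1}\backslash\mathrm{id}_{p_2-p_1}\backslash\cdots\backslash\mathrm{id}_{n-p_k}$ and $C(\mathsf{S})=1_{p_1}\backslash1_{p_2-p_1}\backslash\cdots\backslash1_{n-p_k}$. For $t\in\mathcal{Y}_n$, number its leaves $0,1,\dots,n$ from left to right; $L(t)$ is the set of $i\in[n-1]$ such that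 leaf $i$ is a left child. $R(t)=\{j\in[n-1]: t=r\backslash s\text{ for some }r\in\mathcal{Y}_j,\ s\in\mathcal{Y}_{n-j}\}$. -}

module Defs where

open import Data.Nat using (ℕ; zero; suc; _+_; _∸_; _≤_; _<_; _<?_; _≡ᵇ_; _<ᵇ_)
open import Data.Bool using (Bool; true; false; if_then_else_)
open import Data.List using (List; []; _∷_; _++_; map; length; filter; applyUpTo; take; drop; foldr)
open import Data.List.Relation.Binary.Permutation.Propositional using (_↭_)
open import Data.Product using (Σ; _×_; _,_)
open import Data.Maybe using (Maybe; just; nothing)
open import Data.Fin using (Fin; toℕ)
open import Data.Vec using (Vec; toList)
open import Relation.Binary.PropositionalEquality using (_≡_)
open import Relation.Binary.Construct.Closure.ReflexiveTransitive using (Star)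
import Data.Fin.Subset as Sub

-- Permutations (one-line notation, as lists of values in 1..n)

idP : ℕ → List ℕ
idP n = applyUpTo suc n

IsPerm : ℕ → List ℕ → Set
IsPerm n σ = σ ↭ idP n

-- σ(i), 1-indexed (default 0 outside the range; only used in range)
val : List ℕ → ℕ → ℕ
val []       _             = 0
val (x ∷ xs) zero          = 0
val (x ∷ xs) (suc zero)    = x
val (x ∷ xs) (suc (suc i)) = val xs (suc i)

st : List ℕ → List ℕ
st xs = map (λ a → suc (length (filter (_<? a) xs))) xs

Inv : List ℕ → ℕ → ℕ → Set
Inv σ i j = (1 ≤ i) × (i < j) × (j ≤ length σ) × (val σ j < val σ i)

infix 4 _≤W_
_≤W_ : List ℕ → List ℕ → Set
σ ≤W τ = ∀ i j → Inv σ i j → Inv τ i j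

_∨P_ : List ℕ → List ℕ → List ℕ
σ ∨P τ = map (_+ length τ) σ ++ (suc (length σ + length τ) ∷ τ)

_∖P_ : List ℕ → List ℕ → List ℕ
σ ∖P τ = map (_+ length τ) σ ++ τ

-- Subsets of [n-1]: outputs (Des, GDes, L, R) are predicates on ℕ
-- supported in [n-1]; inputs of C and Z are finite subsets
-- S : Subset (n ∸ 1), where i : Fin (n ∸ 1) stands for p = toℕ i + 1.

SubP : Set₁
SubP = ℕ → Set

memQ : (n : ℕ) → ℕ → Sub.Subset (n ∸ 1) → Set
memQ n p S = Σ (Fin (n ∸ 1)) (λ i → (suc (toℕ i) ≡ p) × (i Sub.∈ S))

infix 4 _⊆P_ _≐_
_⊆P_ : SubP → SubP → Set
A ⊆P B = ∀ p → A p → B p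

inclPQ : (n : ℕ) → SubP → Sub.Subset (n ∸ 1) → Set
inclPQ n A S = ∀ p → A p → memQ n p S

inclQP : (n : ℕ) → Sub.Subset (n ∸ 1) → SubP → Set
inclQP n S A = ∀ p → memQ n p S → A p

_≐_ : SubP → SubP → Set
A ≐ B = ∀ p → (A p → B p) × (B p → A p)

Des : ℕ → List ℕ → SubP
Des n σ p = (1 ≤ p) × (p < n) × (val σ (suc p) < val σ p)

GDes : ℕ → List ℕ → SubP
GDes n σ p = (1 ≤ p) × (p < n) ×
  Σ (List ℕ) (λ α → Σ (List ℕ) (λ β → IsPerm p α × IsPerm (n ∸ p) β × (σ ≡ α ∖P β)))

data Tree : Set where
  leaf : Tree
  _∨T_ : Tree → Tree → Tree

size : Tree → ℕ
size leaf       = 0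
size (l ∨T r) = suc (size l + size r)

data _⇝_ : Tree → Tree → Set where
  rot   : ∀ {a b c} → ((a ∨T b) ∨T c) ⇝ (a ∨T (b ∨T c))
  left  : ∀ {s s' t} → s ⇝ s' → (s ∨T t) ⇝ (s' ∨T t)
  right : ∀ {s t t'} → t ⇝ t' → (s ∨T t) ⇝ (s ∨T t')

infix 4 _≤T_
_≤T_ : Tree → Tree → Set
_≤T_ = Star _⇝_

oneT : ℕ → Tree
oneT zero    = leaf
oneT (suc n) = oneT n ∨T leaf

_∖T_ : Tree → Tree → Tree
leaf ∖T t       = t
(l ∨T r) ∖T t = l ∨T (r ∖T t)

-- leaves numbered 0..n left to right; flag = "is a left child"
leafFlags : Bool → Tree → List Bool
leafFlags b leaf       = b ∷ []
leafFlags b (l ∨T r) = leafFlags true l ++ leafFlags false r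

lookupM : {A : Set} → List A → ℕ → Maybe A
lookupM []       _       = nothing
lookupM (x ∷ xs) zero    = just x
lookupM (x ∷ xs) (suc i) = lookupM xs i

L : ℕ → Tree → SubP
L n t i = (1 ≤ i) × (i < n) × (lookupM (leafFlags false t) i ≡ just true)

R : ℕ → Tree → SubP
R n t j = (1 ≤ j) × (j < n) ×
  Σ Tree (λ r → Σ Tree (λ s → (size r ≡ j) × (size s ≡ n ∸ j) × (t ≡ r ∖T s)))

-- C and Z: S = {p_1 < ... < p_k} gives block sizes
-- p_1, p_2 - p_1, ..., n - p_k

blocksGo : ℕ → List Bool → List ℕ
blocksGo c []           = c ∷ []
blocksGo c (true ∷ bs)  = c ∷ blocksGo 1 bs
blocksGo c (false ∷ bs) = blocksGo (suc c) bs

blocks : (n : ℕ) → Sub.Subset (n ∸ 1) → List ℕ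
blocks zero    S = 0 ∷ []
blocks (suc m) S = blocksGo 1 (toList S)

C : (n : ℕ) → Sub.Subset (n ∸ 1) → Tree
C n S = foldr (λ k acc → oneT k ∖T acc) leaf (blocks n S)

Z : (n : ℕ) → Sub.Subset (n ∸ 1) → List ℕ
Z n S = foldr (λ k acc → idP k ∖P acc) [] (blocks n S)

gam : Tree → List ℕ
gam leaf       = []
gam (l ∨T r) = gam l ∨P gam r

splitAtVal : ℕ → List ℕ → List ℕ × List ℕ
splitAtVal m []       = [] , []
splitAtVal m (x ∷ xs) with m ≡ᵇ x
... | true  = [] , xs
... | false with splitAtVal m xs
...   | (a , b) = (x ∷ a) , b

-- fuel-bounded recursion (fuel = length σ suffices)
lamF : ℕ → List ℕ → Tree
lamF zero    σ = leaf
lamF (suc k) [] = leaf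
lamF (suc k) (x ∷ xs) with splitAtVal (length (x ∷ xs)) (x ∷ xs)
... | (a , b) = lamF k (st a) ∨T lamF k (st b)

lam : List ℕ → Tree
lam σ = lamF (length σ) σ

-- for σ ∈ 𝔖_n and p ∈ [n-1]: p ∈ GDes(σ) iff σ(1..p) are all > n - p
allB : (ℕ → Bool) → List ℕ → Bool
allB f []       = true
allB f (x ∷ xs) = if f x then allB f xs else false

isGDesB : List ℕ → ℕ → Bool
isGDesB σ p = allB (λ x → (length σ ∸ p) <ᵇ x) (take p σ)

firstTrue : (ℕ → Bool) → List ℕ → ℕ → ℕ
firstTrue f []       d = d
firstTrue f (p ∷ ps) d = if f p then p else firstTrue f ps d

-- j = min GDes(σ) if nonempty, else n
rhoJ : List ℕ → ℕ
rhoJ σ = firstTrue (isGDesB σ) (idP (length σ ∸ 1)) (length σ)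

rhoF : ℕ → List ℕ → Tree
rhoF zero    σ = leaf
rhoF (suc k) [] = leaf
rhoF (suc k) (x ∷ xs) =
  rhoF k (st (take (rhoJ (x ∷ xs) ∸ 1) (x ∷ xs))) ∨T
  rhoF k (st (drop (rhoJ (x ∷ xs)) (x ∷ xs)))

rho : List ℕ → Tree
rho σ = rhoF (length σ) σ

{-# OPTIONS --safe #-}
-- Number the nodes of a binary tree 1, …, n in symmetric order and let subtreeStart t j be the
-- first position of the subtree rooted at node j.  The Tamari order is the pointwise order of
-- these vectors: a rotation can only increase them, and a pointwise larger tree is reached by
-- rotating the future root up to the root and recursing on both sides.  For i < j, the pair
-- (i , j) is an inversion of γ(t) exactly when i < subtreeStart t j.  In λ(σ) the subtree of j
-- starts just after the previous larger entry of σ, and ρ(σ) is the greatest tree all of whose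
-- γ-inversions are inversions of σ; this gives λ ⊣ γ and γ ⊣ ρ.  Descents are the adjacent such
-- inversions (left-child leaves), global descents are the cuts that no subtree straddles, and
-- γ ∘ C = Z, whose inversions are the pairs separated by S.  Since γ is an order embedding, the
-- other connections follow from Des ⊣ Z and Z ⊣ GDes, and every map is monotone as an adjoint.
module Submission where

open import Defs
open import Data.Bool using (Bool; true; false; T)
open import Data.Bool.Properties using (T-≡)
open import Data.Empty using (⊥; ⊥-elim)
open import Data.Fin using (Fin; toℕ; zero; suc; fromℕ<)
import Data.Fin.Properties as Fin
open import Data.Fin.Properties using (toℕ<n; toℕ-fromℕ<; any?)
import Data.Fin.Subset as FS
open import Data.Fin.Subset using (Subset; _⊆_; ⁅_⁆)
open import Data.Fin.Subset.Properties using (x∈⁅x⁆; x∈⁅y⁆⇒x≡y)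
open import Data.List using (List; []; _∷_; _++_; map; length; filter; applyUpTo; take; drop; foldr)
open import Data.List.Membership.Propositional using (_∈_)
open import Data.List.Membership.Propositional.Properties using (∈-applyUpTo⁻)
open import Data.List.Properties using (length-++; length-map; length-take; length-applyUpTo; length-drop; ++-assoc; map-++; map-∘; map-cong; map-id; map-id-local; applyUpTo-∷ʳ; take++drop≡id; filter-accept; filter-reject)
open import Data.List.Relation.Binary.Permutation.Propositional using (_↭_; ↭-sym; ↭⇒↭ₛ; prep; module PermutationReasoning) renaming (refl to ↭refl)
open import Data.List.Relation.Binary.Permutation.Propositional.Properties using (∈-resp-↭; ↭-length; shift; ++-comm)
import Data.List.Relation.Unary.All as All
open import Data.List.Relation.Unary.All using (All; []; _∷_)
open import Data.List.Relation.Unary.AllPairs using ([]; _∷_)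
open import Data.List.Relation.Unary.Any using (here; there)
open import Data.List.Relation.Unary.Unique.Propositional using (Unique)
open import Data.List.Relation.Unary.Unique.Propositional.Properties using (applyUpTo⁺₁)
open import Data.Maybe using (just)
open import Data.Nat using (ℕ; zero; suc; _+_; _∸_; _≤_; _<_; z≤n; s≤s; _≤?_; _<?_; _≟_; _≡ᵇ_; _<ᵇ_; _⊔_)
open import Data.Nat.ListAction using (sum)
open import Data.Nat.Properties
open import Data.Product using (Σ; _×_; _,_; proj₁; proj₂; uncurry)
open import Data.Sum using (_⊎_; inj₁; inj₂)
open import Data.Vec using (Vec; toList; []; _∷_; here; there)
open import Data.Vec.Properties using (length-toList)
open import Function.Bundles using (_⇔_; mk⇔; Equivalence)
open import Relation.Binary.Construct.Closure.ReflexiveTransitive using (ε; _◅_; _◅◅_; gmap)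
open import Relation.Binary.Definitions using (tri<; tri≈; tri>)
open import Relation.Binary.PropositionalEquality using (_≡_; _≢_; refl; sym; trans; cong; cong₂; subst; subst₂; setoid; module ≡-Reasoning)
open import Relation.Nullary using (¬_; yes; no)

open import Data.List.Relation.Binary.Permutation.Setoid.Properties (setoid ℕ) using (Unique-resp-↭)

m+suc[n∸suc[m]]≡n : ∀ m n → m < n → m + suc (n ∸ suc m) ≡ n
m+suc[n∸suc[m]]≡n m n m<n = trans (+-suc m (n ∸ suc m)) (m+[n∸m]≡n m<n)

suc[n∸1]≡n : ∀ {n} → 1 ≤ n → suc (n ∸ 1) ≡ n
suc[n∸1]≡n {suc n} _ = refl

<⊔⇒< : ∀ {x a b} → x < a ⊔ b → ¬ (x < b) → x < a
<⊔⇒< {x} {a} {b} h x≮b with a ≤? b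
... | yes a≤b = ⊥-elim (x≮b (subst (x <_) (m≤n⇒m⊔n≡n a≤b) h))
... | no a≰b = subst (x <_) (m≥n⇒m⊔n≡m (<⇒≤ (≰⇒> a≰b))) h

data Position (k j : ℕ) : Set where
  inLeft  : j ≤ k → Position k j
  atRoot : j ≡ suc k → Position k j
  inRight  : (j' : ℕ) → j ≡ suc k + suc j' → Position k j

position : ∀ k j → Position k j
position zero zero = inLeft z≤n
position zero (suc zero) = atRoot refl
position zero (suc (suc j)) = inRight j refl
position (suc k) zero = inLeft z≤n
position (suc k) (suc j) with position k j
... | inLeft p = inLeft (s≤s p)
... | atRoot p = atRoot (cong suc p)
... | inRight j' p = inRight j' (cong suc p)

inRight≰ : ∀ k j' → ¬ (suc k + suc j' ≤ k)
inRight≰ k j' p = 1+n≰n (≤-trans (s≤s (m≤m+n k (suc j'))) p)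

inRight≢atRoot : ∀ k j' → suc k + suc j' ≢ suc k
inRight≢atRoot k j' e = m≢1+m+n k (sym (trans (sym (+-suc k j')) (suc-injective e)))

inRight-injective : ∀ k a b → suc k + suc a ≡ suc k + suc b → a ≡ b
inRight-injective k a b e = suc-injective (+-cancelˡ-≡ (suc k) _ _ e)

subtreeStart : Tree → ℕ → ℕ
subtreeStart leaf j = 1
subtreeStart (l ∨T r) j with position (size l) j
... | inLeft _ = subtreeStart l j
... | atRoot _ = 1
... | inRight j' _ = suc (size l) + subtreeStart r (suc j')

subtreeStart-inLeft : ∀ l r j → j ≤ size l → subtreeStart (l ∨T r) j ≡ subtreeStart l j
subtreeStart-inLeft l r j p with position (size l) j
... | inLeft _ = refl
... | atRoot refl = ⊥-elim (1+n≰n p)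
... | inRight j' refl = ⊥-elim (inRight≰ (size l) j' p)

subtreeStart-atRoot : ∀ l r → subtreeStart (l ∨T r) (suc (size l)) ≡ 1
subtreeStart-atRoot l r with position (size l) (suc (size l))
... | inLeft p = ⊥-elim (1+n≰n p)
... | atRoot _ = refl
... | inRight j' e = ⊥-elim (inRight≢atRoot (size l) j' (sym e))

subtreeStart-inRight : ∀ l r j' → subtreeStart (l ∨T r) (suc (size l) + suc j') ≡ suc (size l) + subtreeStart r (suc j')
subtreeStart-inRight l r j' with position (size l) (suc (size l) + suc j')
... | inLeft p = ⊥-elim (inRight≰ (size l) j' p)
... | atRoot e = ⊥-elim (inRight≢atRoot (size l) j' e)
... | inRight j'' e with inRight-injective (size l) j' j'' e
... | refl = refl

subtreeStart≥1 : ∀ t j → 1 ≤ subtreeStart t j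
subtreeStart≥1 leaf j = s≤s z≤n
subtreeStart≥1 (l ∨T r) j with position (size l) j
... | inLeft _ = subtreeStart≥1 l j
... | atRoot _ = s≤s z≤n
... | inRight j' _ = s≤s z≤n

subtreeStart≤ : ∀ t j → 1 ≤ j → j ≤ size t → subtreeStart t j ≤ j
subtreeStart≤ leaf j o _ = o
subtreeStart≤ (l ∨T r) j o p with position (size l) j
... | inLeft q = subtreeStart≤ l j o q
... | atRoot refl = s≤s z≤n
... | inRight j' refl = +-monoʳ-≤ (suc (size l)) (subtreeStart≤ r (suc j') (s≤s z≤n) q)
  where
  q : suc j' ≤ size r
  q = +-cancelˡ-≤ (size l) _ _ (≤-pred p)

-- The Tamari order as the pointwise order of subtree starts
⇝-size : ∀ {s t} → s ⇝ t → size s ≡ size t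
⇝-size (rot {a} {b} {c}) = cong suc (trans (cong (_+ size c) (sym (+-suc (size a) (size b)))) (+-assoc (size a) (suc (size b)) (size c)))
⇝-size (left p) = cong (λ x → suc (x + _)) (⇝-size p)
⇝-size (right {s} p) = cong (λ x → suc (size s + x)) (⇝-size p)

≤T-size : ∀ {s t} → s ≤T t → size s ≡ size t
≤T-size ε = refl
≤T-size (p ◅ ps) = trans (⇝-size p) (≤T-size ps)

subtreeStart-rot : ∀ a b c j → subtreeStart ((a ∨T b) ∨T c) j ≤ subtreeStart (a ∨T (b ∨T c)) j
subtreeStart-rot a b c j with position (size a) j
... | inLeft p = ≤-reflexive (trans (subtreeStart-inLeft (a ∨T b) c j (≤-trans p (≤-trans (m≤m+n _ _) (n≤1+n _)))) (subtreeStart-inLeft a b j p))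
... | atRoot refl = ≤-reflexive (trans (subtreeStart-inLeft (a ∨T b) c (suc (size a)) (s≤s (m≤m+n _ _))) (subtreeStart-atRoot a b))
... | inRight j' refl with position (size b) (suc j')
...   | inLeft q = ≤-reflexive (trans (subtreeStart-inLeft (a ∨T b) c _ (s≤s (+-monoʳ-≤ (size a) q))) (subtreeStart-inRight a b j'))
...   | atRoot e = ≤-trans (≤-reflexive (trans (cong (subtreeStart ((a ∨T b) ∨T c)) eq) (subtreeStart-atRoot (a ∨T b) c))) (s≤s z≤n)
  where
  eq : suc (size a) + suc j' ≡ suc (size (a ∨T b))
  eq = trans (cong (suc (size a) +_) e) (cong suc (+-suc (size a) (size b)))
...   | inRight j'' e = ≤-reflexive (trans (cong (subtreeStart ((a ∨T b) ∨T c)) eq) (trans (subtreeStart-inRight (a ∨T b) c j'') ar))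
  where
  eq : suc (size a) + suc j' ≡ suc (size (a ∨T b)) + suc j''
  eq = trans (cong (suc (size a) +_) e) (cong suc (trans (sym (+-assoc (size a) (suc (size b)) (suc j''))) (cong (_+ suc j'') (+-suc (size a) (size b)))))
  ar : suc (size (a ∨T b)) + subtreeStart c (suc j'') ≡ suc (size a) + (suc (size b) + subtreeStart c (suc j''))
  ar = cong suc (trans (cong (_+ subtreeStart c (suc j'')) (sym (+-suc (size a) (size b)))) (+-assoc (size a) (suc (size b)) _))

subtreeStart-⇝ : ∀ {s t} → s ⇝ t → ∀ j → subtreeStart s j ≤ subtreeStart t j
subtreeStart-⇝ (rot {a} {b} {c}) j = subtreeStart-rot a b c j
subtreeStart-⇝ (left {s} {s'} {t} p) j with ⇝-size p
... | e with position (size s) j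
...   | inLeft q = subst (subtreeStart s j ≤_) (sym (subtreeStart-inLeft s' t j (subst (j ≤_) e q))) (subtreeStart-⇝ p j)
...   | atRoot refl = subtreeStart≥1 (s' ∨T t) _
...   | inRight j' refl = ≤-reflexive (sym (trans (cong (λ x → subtreeStart (s' ∨T t) (suc x + suc j')) e)
                              (trans (subtreeStart-inRight s' t j') (cong (λ x → suc x + subtreeStart t (suc j')) (sym e)))))
subtreeStart-⇝ (right {s} {t} {t'} p) j with position (size s) j
... | inLeft q = ≤-refl
... | atRoot refl = ≤-refl
... | inRight j' refl = +-monoʳ-≤ (suc (size s)) (subtreeStart-⇝ p (suc j'))

subtreeStart-mono : ∀ {s t} → s ≤T t → ∀ j → subtreeStart s j ≤ subtreeStart t j
subtreeStart-mono ε j = ≤-refl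
subtreeStart-mono (p ◅ ps) j = ≤-trans (subtreeStart-⇝ p j) (subtreeStart-mono ps j)

∨T-mono : ∀ {s s' t t'} → s ≤T s' → t ≤T t' → (s ∨T t) ≤T (s' ∨T t')
∨T-mono {s} {s'} {t} {t'} p q = gmap (λ x → x ∨T t) left p ◅◅ gmap (λ x → s' ∨T x) right q

-- If the subtree of node p starts at 1, rotations raise p to the root; the subtrees
-- of the nodes after p are then cut off at p + 1, whence the ⊔.
record RaisedRoot (s : Tree) (p : ℕ) : Set where
  field
    leftPart rightPart : Tree
    raised          : s ≤T (leftPart ∨T rightPart)
    size-leftPart   : suc (size leftPart) ≡ p
    size≡-raised    : size s ≡ suc (size leftPart + size rightPart)
    start-leftPart  : ∀ j → j < p → subtreeStart leftPart j ≡ subtreeStart s j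
    start-rightPart : ∀ j' → p + subtreeStart rightPart (suc j') ≡ subtreeStart s (p + suc j') ⊔ suc p

raiseRoot-right : ∀ l r u2 p → size l ≡ p + size u2 →
  (∀ j' → p + subtreeStart u2 (suc j') ≡ subtreeStart l (p + suc j') ⊔ suc p) →
  ∀ j' → p + subtreeStart (u2 ∨T r) (suc j') ≡ subtreeStart (l ∨T r) (p + suc j') ⊔ suc p
raiseRoot-right l r u2 p hl ih j' with position (size u2) (suc j')
... | inLeft q = trans (ih j') (cong (_⊔ suc p) (sym (subtreeStart-inLeft l r (p + suc j') (subst (p + suc j' ≤_) (sym hl) (+-monoʳ-≤ p q)))))
... | atRoot e = trans (+-comm p 1) (sym (cong (_⊔ suc p) (trans (cong (subtreeStart (l ∨T r)) eq) (subtreeStart-atRoot l r))))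
  where
  eq : p + suc j' ≡ suc (size l)
  eq = trans (cong (p +_) e) (trans (+-suc p _) (cong suc (sym hl)))
... | inRight j'' e = trans ar (sym (trans (cong (λ x → subtreeStart (l ∨T r) x ⊔ suc p) eq) (trans (cong (_⊔ suc p) (subtreeStart-inRight l r j'')) (m≥n⇒m⊔n≡m big))))
  where
  eq : p + suc j' ≡ suc (size l) + suc j''
  eq = trans (cong (p +_) e) (trans (sym (+-assoc p (suc (size u2)) (suc j''))) (cong (_+ suc j'') (trans (+-suc p _) (cong suc (sym hl)))))
  ar : p + (suc (size u2) + subtreeStart r (suc j'')) ≡ suc (size l) + subtreeStart r (suc j'')
  ar = trans (sym (+-assoc p (suc (size u2)) _)) (cong (_+ subtreeStart r (suc j'')) (trans (+-suc p _) (cong suc (sym hl))))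
  big : suc p ≤ suc (size l) + subtreeStart r (suc j'')
  big = ≤-trans (s≤s (subst (p ≤_) (sym hl) (m≤m+n p _))) (m≤m+n (suc (size l)) _)

raiseRoot : ∀ s p → 1 ≤ p → p ≤ size s → subtreeStart s p ≡ 1 → RaisedRoot s p
raiseRoot leaf p o q e = ⊥-elim (1+n≰n (≤-trans o q))
raiseRoot (l ∨T r) p o q e with position (size l) p
... | atRoot refl = record
  { leftPart = l ; rightPart = r ; raised = ε ; size-leftPart = refl ; size≡-raised = refl
  ; start-leftPart = λ j j< → sym (subtreeStart-inLeft l r j (≤-pred j<))
  ; start-rightPart = λ j' → sym (trans (cong (_⊔ suc (suc (size l))) (subtreeStart-inRight l r j')) (m≥n⇒m⊔n≡m (s≤s (m<m+n (size l) (subtreeStart≥1 r (suc j')))))) }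
... | inRight j' refl = ⊥-elim (1+n≰n (≤-trans (subtreeStart≥1 r (suc j')) (subst (subtreeStart r (suc j') ≤_) (suc-injective e) (m≤n+m _ (size l)))))
... | inLeft pl = record
  { leftPart = RaisedRoot.leftPart ih ; rightPart = RaisedRoot.rightPart ih ∨T r
  ; raised = ∨T-mono (RaisedRoot.raised ih) ε ◅◅ (rot ◅ ε)
  ; size-leftPart = RaisedRoot.size-leftPart ih
  ; size≡-raised = cong suc (trans (cong (_+ size r) (RaisedRoot.size≡-raised ih))
                     (trans (cong suc (+-assoc (size (RaisedRoot.leftPart ih)) (size (RaisedRoot.rightPart ih)) (size r)))
                            (sym (+-suc (size (RaisedRoot.leftPart ih)) _))))
  ; start-leftPart = λ j j< → trans (RaisedRoot.start-leftPart ih j j<) (sym (subtreeStart-inLeft l r j (≤-trans (<⇒≤ j<) pl)))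
  ; start-rightPart = raiseRoot-right l r (RaisedRoot.rightPart ih) p hl (RaisedRoot.start-rightPart ih) }
  where
  ih : RaisedRoot l p
  ih = raiseRoot l p o pl e
  hl : size l ≡ p + size (RaisedRoot.rightPart ih)
  hl = trans (RaisedRoot.size≡-raised ih) (cong (_+ size (RaisedRoot.rightPart ih)) (RaisedRoot.size-leftPart ih))

size≡0⇒leaf : ∀ s → size s ≡ 0 → s ≡ leaf
size≡0⇒leaf leaf _ = refl
size≡0⇒leaf (_ ∨T _) ()

subtreeStart-≤⇒≤T : ∀ t s → size s ≡ size t → (∀ j → 1 ≤ j → j ≤ size t → subtreeStart s j ≤ subtreeStart t j) → s ≤T t
subtreeStart-≤⇒≤T leaf s e h rewrite size≡0⇒leaf s e = ε
subtreeStart-≤⇒≤T (tl ∨T tr) s e h = RaisedRoot.raised RR ◅◅ ∨T-mono (subtreeStart-≤⇒≤T tl s1 e1 h1) (subtreeStart-≤⇒≤T tr s2 e2 h2)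
  where
  p : ℕ
  p = suc (size tl)
  pl : p ≤ size s
  pl = subst (p ≤_) (sym e) (s≤s (m≤m+n _ _))
  lp : subtreeStart s p ≡ 1
  lp = ≤-antisym (subst (subtreeStart s p ≤_) (subtreeStart-atRoot tl tr) (h p (s≤s z≤n) (s≤s (m≤m+n _ _)))) (subtreeStart≥1 s p)
  RR : RaisedRoot s p
  RR = raiseRoot s p (s≤s z≤n) pl lp
  s1 s2 : Tree
  s1 = RaisedRoot.leftPart RR
  s2 = RaisedRoot.rightPart RR
  e1 : size s1 ≡ size tl
  e1 = suc-injective (RaisedRoot.size-leftPart RR)
  e2 : size s2 ≡ size tr
  e2 = +-cancelˡ-≡ (size tl) _ _ (suc-injective (trans (sym (trans (RaisedRoot.size≡-raised RR) (cong (λ x → suc (x + size s2)) e1))) e))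
  h1 : ∀ j → 1 ≤ j → j ≤ size tl → subtreeStart s1 j ≤ subtreeStart tl j
  h1 j o q = subst₂ _≤_ (sym (RaisedRoot.start-leftPart RR j (s≤s q))) (subtreeStart-inLeft tl tr j q) (h j o (≤-trans q (≤-trans (m≤m+n _ _) (n≤1+n _))))
  h2 : ∀ j → 1 ≤ j → j ≤ size tr → subtreeStart s2 j ≤ subtreeStart tr j
  h2 (suc j'') o q = +-cancelˡ-≤ p _ _ (subst (_≤ p + subtreeStart tr (suc j'')) (sym (RaisedRoot.start-rightPart RR j''))
        (⊔-lub (subst (subtreeStart s (p + suc j'') ≤_) (subtreeStart-inRight tl tr j'') (h (p + suc j'') (s≤s z≤n) (s≤s (+-monoʳ-≤ (size tl) q))))
               (m<m+n p (subtreeStart≥1 tr (suc j'')))))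

subtreeStart-nested : ∀ t j i → j ≤ size t → subtreeStart t j ≤ i → i < j → subtreeStart t j ≤ subtreeStart t i
subtreeStart-nested leaf j i q h ij = ⊥-elim (n≮0 (≤-trans ij q))
subtreeStart-nested (l ∨T r) j i q h ij with position (size l) j
... | inLeft q' = subst (subtreeStart l j ≤_) (sym (subtreeStart-inLeft l r i (≤-trans (<⇒≤ ij) q'))) (subtreeStart-nested l j i q' h ij)
... | atRoot _ = subtreeStart≥1 (l ∨T r) i
... | inRight j' refl with position (size l) i
...   | inLeft q' = ⊥-elim (1+n≰n (≤-trans (m≤m+n (suc (size l)) _) (≤-trans h q')))
...   | atRoot refl = ⊥-elim (1+n≰n (≤-trans (m<m+n (size l) (subtreeStart≥1 r (suc j'))) (≤-pred h)))
...   | inRight i' refl = +-monoʳ-≤ (suc (size l)) (subtreeStart-nested r (suc j') (suc i')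
                            (+-cancelˡ-≤ (size l) _ _ (≤-pred q)) (+-cancelˡ-≤ (suc (size l)) _ _ h) (+-cancelˡ-< (suc (size l)) _ _ ij))

subtreeStart-0 : ∀ t → subtreeStart t 0 ≡ 1
subtreeStart-0 leaf = refl
subtreeStart-0 (l ∨T r) with position (size l) 0
... | inLeft _ = subtreeStart-0 l
... | atRoot ()
... | inRight _ ()

size-∖T : ∀ r s → size (r ∖T s) ≡ size r + size s
size-∖T leaf s = refl
size-∖T (l ∨T r) s = cong suc (trans (cong (size l +_) (size-∖T r s)) (sym (+-assoc (size l) (size r) (size s))))

size-oneT : ∀ p → size (oneT p) ≡ p
size-oneT zero = refl
size-oneT (suc p) = cong suc (trans (+-identityʳ _) (size-oneT p))

subtreeStart-∖T-left : ∀ r s j → j ≤ size r → subtreeStart (r ∖T s) j ≡ subtreeStart r j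
subtreeStart-∖T-left leaf s zero _ = subtreeStart-0 s
subtreeStart-∖T-left (l ∨T r) s j q with position (size l) j
... | inLeft _ = refl
... | atRoot _ = refl
... | inRight j' refl = cong (suc (size l) +_) (subtreeStart-∖T-left r s (suc j') (+-cancelˡ-≤ (size l) _ _ (≤-pred q)))

subtreeStart-∖T-right : ∀ r s j' → subtreeStart (r ∖T s) (size r + suc j') ≡ size r + subtreeStart s (suc j')
subtreeStart-∖T-right leaf s j' = refl
subtreeStart-∖T-right (l ∨T r) s j' = begin
  subtreeStart (l ∨T (r ∖T s)) (suc (size l + size r) + suc j')   ≡⟨ cong (subtreeStart (l ∨T (r ∖T s))) position≡ ⟩
  subtreeStart (l ∨T (r ∖T s)) (suc (size l) + suc (size r + j'))  ≡⟨ subtreeStart-inRight l (r ∖T s) (size r + j') ⟩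
  suc (size l) + subtreeStart (r ∖T s) (suc (size r + j'))         ≡⟨ cong (λ x → suc (size l) + subtreeStart (r ∖T s) x) (+-suc (size r) j') ⟨
  suc (size l) + subtreeStart (r ∖T s) (size r + suc j')           ≡⟨ cong (suc (size l) +_) (subtreeStart-∖T-right r s j') ⟩
  suc (size l) + (size r + subtreeStart s (suc j'))                ≡⟨ cong suc (+-assoc (size l) (size r) _) ⟨
  suc (size l + size r) + subtreeStart s (suc j')                  ∎
  where
  open ≡-Reasoning
  position≡ : suc (size l + size r) + suc j' ≡ suc (size l) + suc (size r + j')
  position≡ = cong suc (trans (+-assoc (size l) (size r) (suc j')) (cong (size l +_) (+-suc (size r) j')))

subtreeStart-oneT : ∀ p j → j ≤ p → subtreeStart (oneT p) j ≡ 1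
subtreeStart-oneT zero j _ = refl
subtreeStart-oneT (suc p) j q with position (size (oneT p)) j
... | inLeft q' = subtreeStart-oneT p j (subst (j ≤_) (size-oneT p) q')
... | atRoot _ = refl
... | inRight j' refl = ⊥-elim (m+1+n≰m (size (oneT p)) (subst (size (oneT p) + suc j' ≤_) (sym (size-oneT p)) (≤-pred q)))

val-0 : ∀ xs → val xs 0 ≡ 0
val-0 [] = refl
val-0 (x ∷ xs) = refl

val-cons : ∀ x xs m → 1 ≤ m → val (x ∷ xs) (suc m) ≡ val xs m
val-cons x xs (suc m) _ = refl

val-++ˡ : ∀ xs ys i → i ≤ length xs → val (xs ++ ys) i ≡ val xs i
val-++ˡ [] ys zero _ = val-0 ys
val-++ˡ (x ∷ xs) ys zero _ = refl
val-++ˡ (x ∷ xs) ys (suc zero) _ = refl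
val-++ˡ (x ∷ xs) ys (suc (suc i)) (s≤s q) = val-++ˡ xs ys (suc i) q

val-++ʳ : ∀ xs ys i → val (xs ++ ys) (length xs + suc i) ≡ val ys (suc i)
val-++ʳ [] ys i = refl
val-++ʳ (x ∷ xs) ys i = trans (val-cons x (xs ++ ys) (length xs + suc i) (subst (1 ≤_) (sym (+-suc (length xs) i)) (s≤s z≤n))) (val-++ʳ xs ys i)

val-map : ∀ (f : ℕ → ℕ) xs i → 1 ≤ i → i ≤ length xs → val (map f xs) i ≡ f (val xs i)
val-map f (x ∷ xs) (suc zero) _ _ = refl
val-map f (x ∷ xs) (suc (suc i)) _ (s≤s q) = val-map f xs (suc i) (s≤s z≤n) q

val-take : ∀ p xs i → i ≤ p → val (take p xs) i ≡ val xs i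
val-take p xs zero _ = trans (val-0 (take p xs)) (sym (val-0 xs))
val-take zero xs (suc i) ()
val-take (suc p) [] (suc i) _ = refl
val-take (suc p) (x ∷ xs) (suc zero) _ = refl
val-take (suc p) (x ∷ xs) (suc (suc i)) (s≤s q) = val-take p xs (suc i) q

val-drop : ∀ p xs i → val (drop p xs) (suc i) ≡ val xs (p + suc i)
val-drop zero xs i = refl
val-drop (suc p) [] i = refl
val-drop (suc p) (x ∷ xs) i = trans (val-drop p xs i) (sym (val-cons x xs (p + suc i) (subst (1 ≤_) (sym (+-suc p i)) (s≤s z≤n))))

val∈ : ∀ xs i → 1 ≤ i → i ≤ length xs → val xs i ∈ xs
val∈ (x ∷ xs) (suc zero) _ _ = here refl
val∈ (x ∷ xs) (suc (suc i)) _ (s≤s q) = there (val∈ xs (suc i) (s≤s z≤n) q)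

-- The map γ
length-∨P : ∀ σ τ → length (σ ∨P τ) ≡ suc (length σ + length τ)
length-∨P σ τ = trans (length-++ (map (_+ length τ) σ)) (trans (cong (_+ suc (length τ)) (length-map _ σ)) (+-suc _ _))

length-gam : ∀ t → length (gam t) ≡ size t
length-gam leaf = refl
length-gam (l ∨T r) = trans (length-∨P (gam l) (gam r)) (cong suc (cong₂ _+_ (length-gam l) (length-gam r)))

val-gam-inLeft : ∀ l r i → 1 ≤ i → i ≤ size l → val (gam (l ∨T r)) i ≡ val (gam l) i + size r
val-gam-inLeft l r i o q = trans (val-++ˡ (map (_+ length (gam r)) (gam l)) _ i q1)
   (trans (val-map (_+ length (gam r)) (gam l) i o q2) (cong (val (gam l) i +_) (length-gam r)))
  where
  q2 : i ≤ length (gam l)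
  q2 = subst (i ≤_) (sym (length-gam l)) q
  q1 : i ≤ length (map (_+ length (gam r)) (gam l))
  q1 = subst (i ≤_) (sym (length-map _ (gam l))) q2

length-map-gam : ∀ l r → length (map (_+ length (gam r)) (gam l)) ≡ size l
length-map-gam l r = trans (length-map _ (gam l)) (length-gam l)

val-gam-atRoot : ∀ l r → val (gam (l ∨T r)) (suc (size l)) ≡ suc (size l + size r)
val-gam-atRoot l r = trans (cong (val (gam (l ∨T r))) eq) (trans (val-++ʳ (map (_+ length (gam r)) (gam l)) _ 0) (cong suc (cong₂ _+_ (length-gam l) (length-gam r))))
  where
  eq : suc (size l) ≡ length (map (_+ length (gam r)) (gam l)) + 1
  eq = trans (+-comm 1 (size l)) (cong (_+ 1) (sym (length-map-gam l r)))

val-gam-inRight : ∀ l r j' → val (gam (l ∨T r)) (suc (size l) + suc j') ≡ val (gam r) (suc j')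
val-gam-inRight l r j' = trans (cong (val (gam (l ∨T r))) eq) (val-++ʳ (map (_+ length (gam r)) (gam l)) _ (suc j'))
  where
  eq : suc (size l) + suc j' ≡ length (map (_+ length (gam r)) (gam l)) + suc (suc j')
  eq = trans (sym (+-suc (size l) (suc j'))) (cong (_+ suc (suc j')) (sym (length-map-gam l r)))

val-gam-bounded : ∀ t i → 1 ≤ i → i ≤ size t → (1 ≤ val (gam t) i) × (val (gam t) i ≤ size t)
val-gam-bounded leaf i o q = ⊥-elim (1+n≰n (≤-trans o q))
val-gam-bounded (l ∨T r) i o q with position (size l) i
... | inLeft q' = subst (λ x → 1 ≤ x × x ≤ size (l ∨T r)) (sym (val-gam-inLeft l r i o q'))
      (≤-trans (proj₁ ih) (m≤m+n _ _) , ≤-trans (+-monoˡ-≤ (size r) (proj₂ ih)) (n≤1+n _))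
  where ih = val-gam-bounded l i o q'
... | atRoot refl = subst (λ x → 1 ≤ x × x ≤ size (l ∨T r)) (sym (val-gam-atRoot l r)) (s≤s z≤n , ≤-refl)
... | inRight j' refl = subst (λ x → 1 ≤ x × x ≤ size (l ∨T r)) (sym (val-gam-inRight l r j'))
      (proj₁ ih , ≤-trans (proj₂ ih) (≤-trans (m≤n+m _ (size l)) (n≤1+n _)))
  where ih = val-gam-bounded r (suc j') (s≤s z≤n) (+-cancelˡ-≤ (size l) _ _ (≤-pred q))

gam-compare : ∀ t i j → 1 ≤ i → i < j → j ≤ size t →
    (subtreeStart t j ≤ i → val (gam t) i < val (gam t) j) × (i < subtreeStart t j → val (gam t) j < val (gam t) i)
gam-compare leaf i j o ij q = ⊥-elim (n≮0 (≤-trans ij q))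
gam-compare (l ∨T r) i j o ij q with position (size l) j
... | inLeft qj = (λ h → subst₂ _<_ (sym (val-gam-inLeft l r i o qi)) (sym (val-gam-inLeft l r j oj qj)) (+-monoˡ-< (size r) (proj₁ ih h)))
            , (λ h → subst₂ _<_ (sym (val-gam-inLeft l r j oj qj)) (sym (val-gam-inLeft l r i o qi)) (+-monoˡ-< (size r) (proj₂ ih h)))
  where
  qi : i ≤ size l
  qi = ≤-trans (<⇒≤ ij) qj
  oj : 1 ≤ j
  oj = ≤-trans o (<⇒≤ ij)
  ih : (subtreeStart l j ≤ i → val (gam l) i < val (gam l) j) × (i < subtreeStart l j → val (gam l) j < val (gam l) i)
  ih = gam-compare l i j o ij qj
... | atRoot refl = (λ _ → subst₂ _<_ (sym (val-gam-inLeft l r i o qi)) (sym (val-gam-atRoot l r)) (s≤s (+-monoˡ-≤ (size r) (proj₂ (val-gam-bounded l i o qi)))))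
               , (λ h → ⊥-elim (1+n≰n (≤-trans h o)))
  where qi = ≤-pred ij
... | inRight j' refl with position (size l) i
...   | inLeft qi = (λ h → ⊥-elim (1+n≰n (≤-trans (m≤m+n (suc (size l)) _) (≤-trans h qi))))
              , (λ _ → subst₂ _<_ (sym (val-gam-inRight l r j')) (sym (val-gam-inLeft l r i o qi))
                   (≤-trans (s≤s (proj₂ (val-gam-bounded r (suc j') (s≤s z≤n) qr))) (+-monoˡ-≤ (size r) (proj₁ (val-gam-bounded l i o qi)))))
  where qr = +-cancelˡ-≤ (size l) _ _ (≤-pred q)
...   | atRoot refl = (λ h → ⊥-elim (1+n≰n (≤-trans (s≤s (m<m+n (size l) (subtreeStart≥1 r (suc j')))) h)))
              , (λ _ → subst₂ _<_ (sym (val-gam-inRight l r j')) (sym (val-gam-atRoot l r))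
                   (s≤s (≤-trans (proj₂ (val-gam-bounded r (suc j') (s≤s z≤n) qr)) (m≤n+m _ _))))
  where qr = +-cancelˡ-≤ (size l) _ _ (≤-pred q)
...   | inRight i' refl = (λ h → subst₂ _<_ (sym (val-gam-inRight l r i')) (sym (val-gam-inRight l r j')) (proj₁ ih (+-cancelˡ-≤ (suc (size l)) _ _ h)))
                 , (λ h → subst₂ _<_ (sym (val-gam-inRight l r j')) (sym (val-gam-inRight l r i')) (proj₂ ih (+-cancelˡ-< (suc (size l)) _ _ h)))
  where
  ih : (subtreeStart r (suc j') ≤ suc i' → val (gam r) (suc i') < val (gam r) (suc j'))
     × (suc i' < subtreeStart r (suc j') → val (gam r) (suc j') < val (gam r) (suc i'))
  ih = gam-compare r (suc i') (suc j') (s≤s z≤n) (+-cancelˡ-< (suc (size l)) _ _ ij) (+-cancelˡ-≤ (size l) _ _ (≤-pred q))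

MapsInto : ℕ → ℕ → (ℕ → ℕ) → Set
MapsInto k m f = ∀ i → 1 ≤ i → i ≤ k → 1 ≤ f i × f i ≤ m

InjectiveOn : ℕ → (ℕ → ℕ) → Set
InjectiveOn n f = ∀ i j → 1 ≤ i → i ≤ n → 1 ≤ j → j ≤ n → f i ≡ f j → i ≡ j

-- A superscript ᵛ marks the positional form of a notion, stated through val.
record IsPermᵛ (n : ℕ) (σ : List ℕ) : Set where
  field
    length≡   : length σ ≡ n
    bounded   : MapsInto n n (val σ)
    injective : InjectiveOn n (val σ)

open IsPermᵛ

≤suc∧≢⇒≤ : ∀ {x m} → x ≤ suc m → x ≢ suc m → x ≤ m
≤suc∧≢⇒≤ p q = ≤-pred (≤∧≢⇒< p q)

pigeonhole : ∀ k m (f : ℕ → ℕ) → MapsInto k m f → InjectiveOn k f → k ≤ m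
pigeonhole k m f f-bounded f-injective = ≮⇒≥ no-collision
  where
  at : Fin k → ℕ
  at i = suc (toℕ i)
  at-bounded : ∀ i → 1 ≤ f (at i) × f (at i) ≤ m
  at-bounded i = f-bounded (at i) (s≤s z≤n) (toℕ<n i)
  pred< : ∀ {v} → 1 ≤ v → v ≤ m → v ∸ 1 < m
  pred< {suc v} _ v≤m = v≤m
  g : Fin k → Fin m
  g i = fromℕ< (uncurry pred< (at-bounded i))
  no-collision : ¬ m < k
  no-collision m<k with Fin.pigeonhole m<k g
  ... | i , j , i<j , gi≡gj = <-irrefl (suc-injective at-i≡at-j) i<j
    where
    f-pred≡ : f (at i) ∸ 1 ≡ f (at j) ∸ 1
    f-pred≡ = trans (sym (toℕ-fromℕ< _)) (trans (cong toℕ gi≡gj) (toℕ-fromℕ< _))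
    f≡ : f (at i) ≡ f (at j)
    f≡ = trans (sym (m∸n+n≡m (proj₁ (at-bounded i)))) (trans (cong (_+ 1) f-pred≡) (m∸n+n≡m (proj₁ (at-bounded j))))
    at-i≡at-j : at i ≡ at j
    at-i≡at-j = f-injective (at i) (at j) (s≤s z≤n) (toℕ<n i) (s≤s z≤n) (toℕ<n j) f≡

maxPosition : ∀ m σ → IsPermᵛ (suc m) σ → Σ ℕ λ i0 → (i0 ≤ m) × (val σ (suc i0) ≡ suc m)
maxPosition m σ d with any? (λ i → val σ (suc (toℕ i)) ≟ suc m)
... | yes (i , e) = toℕ i , ≤-pred (toℕ<n i) , e
... | no none = ⊥-elim (1+n≰n (pigeonhole (suc m) m (val σ) below-max (injective d)))
  where
  below-max : MapsInto (suc m) m (val σ)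
  below-max (suc i) o q = proj₁ (bounded d (suc i) o q)
                        , ≤suc∧≢⇒≤ (proj₂ (bounded d (suc i) o q)) (λ e → none (fromℕ< q , subst (λ x → val σ (suc x) ≡ suc m) (sym (toℕ-fromℕ< q)) e))

Unique⇒val-injective : ∀ xs → Unique xs → InjectiveOn (length xs) (val xs)
Unique⇒val-injective (x ∷ xs) (a ∷ u) (suc zero) (suc zero) _ _ _ _ _ = refl
Unique⇒val-injective (x ∷ xs) (a ∷ u) (suc zero) (suc (suc j)) _ _ _ (s≤s q') e = ⊥-elim (All.lookup a (val∈ xs (suc j) (s≤s z≤n) q') e)
Unique⇒val-injective (x ∷ xs) (a ∷ u) (suc (suc i)) (suc zero) _ (s≤s q) _ _ e = ⊥-elim (All.lookup a (val∈ xs (suc i) (s≤s z≤n) q) (sym e))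
Unique⇒val-injective (x ∷ xs) (a ∷ u) (suc (suc i)) (suc (suc j)) _ (s≤s q) _ (s≤s q') e = cong suc (Unique⇒val-injective xs u (suc i) (suc j) (s≤s z≤n) q (s≤s z≤n) q' e)

Unique-idP : ∀ n → Unique (idP n)
Unique-idP n = applyUpTo⁺₁ suc n (λ i<j _ e → <⇒≢ i<j (suc-injective e))

IsPerm⇒IsPermᵛ : ∀ n σ → IsPerm n σ → IsPermᵛ n σ
IsPerm⇒IsPermᵛ n σ p = record { length≡ = len ; bounded = rng ; injective = inj }
  where
  len : length σ ≡ n
  len = trans (↭-length p) (length-applyUpTo suc n)
  rng : MapsInto n n (val σ)
  rng i o q with ∈-applyUpTo⁻ suc (∈-resp-↭ p (val∈ σ i o (subst (i ≤_) (sym len) q)))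
  ... | k , k<n , e = subst (λ x → 1 ≤ x × x ≤ n) (sym e) (s≤s z≤n , k<n)
  inj : InjectiveOn n (val σ)
  inj = subst (λ x → InjectiveOn x (val σ)) len (Unique⇒val-injective σ (Unique-resp-↭ (↭⇒↭ₛ (↭-sym p)) (Unique-idP n)))

length-take-≤ : ∀ i (xs : List ℕ) → i ≤ length xs → length (take i xs) ≡ i
length-take-≤ i xs q = trans (length-take i xs) (m≤n⇒m⊓n≡m q)

take-val-drop : ∀ (σ : List ℕ) i0 → suc i0 ≤ length σ → σ ≡ take i0 σ ++ (val σ (suc i0) ∷ drop (suc i0) σ)
take-val-drop (x ∷ σ) zero _ = refl
take-val-drop (x ∷ σ) (suc i0) (s≤s q) = cong (x ∷_) (take-val-drop σ i0 q)

data Split (k p : ℕ) : Set where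
  before : p ≤ k → Split k p
  after : (p' : ℕ) → p ≡ k + suc p' → Split k p

split : ∀ k p → Split k p
split k p with position k p
... | inLeft q = before q
... | atRoot e = after 0 (trans e (+-comm 1 k))
... | inRight p' e = after (suc p') (trans e (sym (+-suc k (suc p'))))

IsPermᵛ-removeMax : ∀ m σ i0 → IsPermᵛ (suc m) σ → suc i0 ≤ suc m → val σ (suc i0) ≡ suc m → IsPermᵛ m (take i0 σ ++ drop (suc i0) σ)
IsPermᵛ-removeMax m σ i0 d q e = record { length≡ = len ; bounded = rng ; injective = inj }
  where
  open IsPermᵛ d renaming (length≡ to lenσ; bounded to rngσ; injective to injσ)
  qσ : suc i0 ≤ length σ
  qσ = subst (suc i0 ≤_) (sym lenσ) q
  lt : length (take i0 σ) ≡ i0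
  lt = length-take-≤ i0 σ (≤-trans (n≤1+n i0) qσ)
  τ : List ℕ
  τ = take i0 σ ++ drop (suc i0) σ
  len : length τ ≡ m
  len = trans (length-++ (take i0 σ)) (trans (cong₂ _+_ lt (trans (length-drop (suc i0) σ) (cong (_∸ suc i0) lenσ))) (m+[n∸m]≡n (≤-pred q)))
  skip : ℕ → ℕ
  skip p with split i0 p
  ... | before _ = p
  ... | after p' _ = suc p
  skip-spec : ∀ p → 1 ≤ p → p ≤ m → (val τ p ≡ val σ (skip p)) × (1 ≤ skip p) × (skip p ≤ suc m) × (skip p ≢ suc i0)
  skip-spec p o pm with split i0 p
  ... | before pl = trans (val-++ˡ (take i0 σ) _ p (subst (p ≤_) (sym lt) pl)) (val-take i0 σ p pl) , o , ≤-trans pm (n≤1+n m) , (λ e' → 1+n≰n (subst (_≤ i0) e' pl))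
  ... | after p' refl = trans (cong (val τ) (cong (_+ suc p') (sym lt))) (trans (val-++ʳ (take i0 σ) _ p') (val-drop (suc i0) σ p')) ,
                      s≤s z≤n , s≤s pm , (λ e' → m+1+n≰m i0 (≤-reflexive (suc-injective e')))
  skip-injective : ∀ p p' → 1 ≤ p → 1 ≤ p' → skip p ≡ skip p' → p ≡ p'
  skip-injective p p' o o' e' with split i0 p | split i0 p'
  ... | before _ | before _ = e'
  ... | before a | after b refl = ⊥-elim (m+1+n≰m i0 (≤-trans (n≤1+n _) (≤-trans (≤-reflexive (sym e')) a)))
  ... | after b refl | before a = ⊥-elim (m+1+n≰m i0 (≤-trans (n≤1+n _) (≤-trans (≤-reflexive e') a)))
  ... | after _ _ | after _ _ = suc-injective e'
  rng : MapsInto m m (val τ)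
  rng p o pm with skip-spec p o pm
  ... | ev , ho , hm , hne = subst (λ x → 1 ≤ x × x ≤ m) (sym ev)
    (proj₁ r , ≤suc∧≢⇒≤ (proj₂ r) (λ e2 → hne (injσ (skip p) (suc i0) ho hm (s≤s z≤n) q (trans e2 (sym e)))))
    where r = rngσ (skip p) ho hm
  inj : InjectiveOn m (val τ)
  inj p p' o pm o' pm' e' with skip-spec p o pm | skip-spec p' o' pm'
  ... | ev , ho , hm , _ | ev' , ho' , hm' , _ = skip-injective p p' o o' (injσ (skip p) (skip p') ho hm ho' hm' (trans (sym ev) (trans e' ev')))

IsPermᵛ⇒IsPerm : ∀ n σ → IsPermᵛ n σ → IsPerm n σ
IsPermᵛ⇒IsPerm zero [] d = ↭refl
IsPermᵛ⇒IsPerm zero (x ∷ σ) d with length≡ d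
... | ()
IsPermᵛ⇒IsPerm (suc m) σ d with maxPosition m σ d
... | i0 , i0≤m , e = begin
  σ                                         ≡⟨ σ≡ ⟩
  take i0 σ ++ suc m ∷ drop (suc i0) σ      ↭⟨ shift (suc m) (take i0 σ) (drop (suc i0) σ) ⟩
  suc m ∷ take i0 σ ++ drop (suc i0) σ      ↭⟨ prep (suc m) (IsPermᵛ⇒IsPerm m _ (IsPermᵛ-removeMax m σ i0 d (s≤s i0≤m) e)) ⟩
  suc m ∷ idP m                             ↭⟨ ++-comm (suc m ∷ []) (idP m) ⟩
  idP m ++ suc m ∷ []                       ≡⟨ applyUpTo-∷ʳ suc m ⟩
  idP (suc m)                               ∎
  where
  open PermutationReasoning
  σ≡ : σ ≡ take i0 σ ++ suc m ∷ drop (suc i0) σ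
  σ≡ = trans (take-val-drop σ i0 (subst (suc i0 ≤_) (sym (length≡ d)) (s≤s i0≤m))) (cong (λ x → take i0 σ ++ x ∷ drop (suc i0) σ) e)

countBelow : List ℕ → ℕ → ℕ
countBelow xs a = length (filter (_<? a) xs)

data CountStep (x a : ℕ) (xs : List ℕ) : Set where
  counted : x < a → countBelow (x ∷ xs) a ≡ suc (countBelow xs a) → CountStep x a xs
  skipped : ¬ x < a → countBelow (x ∷ xs) a ≡ countBelow xs a → CountStep x a xs

countStep : ∀ x a xs → CountStep x a xs
countStep x a xs with x <? a
... | yes p = counted p (cong length (filter-accept (_<? a) p))
... | no np = skipped np (cong length (filter-reject (_<? a) np))

countBelow≤length : ∀ xs a → countBelow xs a ≤ length xs
countBelow≤length [] a = z≤n
countBelow≤length (x ∷ xs) a with countStep x a xs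
... | counted _ e rewrite e = s≤s (countBelow≤length xs a)
... | skipped _ e rewrite e = ≤-trans (countBelow≤length xs a) (n≤1+n _)

countBelow-mono : ∀ xs {a b} → a ≤ b → countBelow xs a ≤ countBelow xs b
countBelow-mono [] _ = z≤n
countBelow-mono (x ∷ xs) {a} {b} ab with countStep x a xs | countStep x b xs
... | counted _ e | counted _ e' rewrite e | e' = s≤s (countBelow-mono xs ab)
... | counted p _ | skipped np _ = ⊥-elim (np (<-≤-trans p ab))
... | skipped _ e | counted _ e' rewrite e | e' = ≤-trans (countBelow-mono xs ab) (n≤1+n _)
... | skipped _ e | skipped _ e' rewrite e | e' = countBelow-mono xs ab

countBelow-strict : ∀ xs {a b} → a < b → a ∈ xs → countBelow xs a < countBelow xs b
countBelow-strict (x ∷ xs) {a} {b} ab (here refl) with countStep x a xs | countStep x b xs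
... | counted p _ | _ = ⊥-elim (<-irrefl refl p)
... | skipped _ e | counted _ e' rewrite e | e' = s≤s (countBelow-mono xs (<⇒≤ ab))
... | skipped _ _ | skipped np _ = ⊥-elim (np ab)
countBelow-strict (x ∷ xs) {a} {b} ab (there m) with countStep x a xs | countStep x b xs
... | counted _ e | counted _ e' rewrite e | e' = s≤s (countBelow-strict xs ab m)
... | counted p _ | skipped np _ = ⊥-elim (np (<-trans p ab))
... | skipped _ e | counted _ e' rewrite e | e' = ≤-trans (countBelow-strict xs ab m) (n≤1+n _)
... | skipped _ e | skipped _ e' rewrite e | e' = countBelow-strict xs ab m

countBelow<length : ∀ xs {a} → a ∈ xs → countBelow xs a < length xs
countBelow<length (x ∷ xs) {a} (here refl) with countStep x a xs
... | counted p _ = ⊥-elim (<-irrefl refl p)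
... | skipped _ e rewrite e = s≤s (countBelow≤length xs a)
countBelow<length (x ∷ xs) {a} (there m) with countStep x a xs
... | counted _ e rewrite e = s≤s (countBelow<length xs m)
... | skipped _ e rewrite e = ≤-trans (countBelow<length xs m) (n≤1+n _)

val-st : ∀ xs i → 1 ≤ i → i ≤ length xs → val (st xs) i ≡ suc (countBelow xs (val xs i))
val-st xs i o q = val-map (λ a → suc (length (filter (_<? a) xs))) xs i o q

st-< : ∀ xs i j → 1 ≤ i → i ≤ length xs → 1 ≤ j → j ≤ length xs → val xs i < val xs j → val (st xs) i < val (st xs) j
st-< xs i j o q o' q' lt = subst₂ _<_ (sym (val-st xs i o q)) (sym (val-st xs j o' q')) (s≤s (countBelow-strict xs lt (val∈ xs i o q)))

st-≤ : ∀ xs i j → 1 ≤ i → i ≤ length xs → 1 ≤ j → j ≤ length xs → val xs i ≤ val xs j → val (st xs) i ≤ val (st xs) j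
st-≤ xs i j o q o' q' le = subst₂ _≤_ (sym (val-st xs i o q)) (sym (val-st xs j o' q')) (s≤s (countBelow-mono xs le))

st-<⁻ : ∀ xs i j → 1 ≤ i → i ≤ length xs → 1 ≤ j → j ≤ length xs → val (st xs) i < val (st xs) j → val xs i < val xs j
st-<⁻ xs i j o q o' q' lt with val xs i <? val xs j
... | yes p = p
... | no np = ⊥-elim (<⇒≱ lt (st-≤ xs j i o' q' o q (≮⇒≥ np)))

st-IsPermᵛ : ∀ xs → InjectiveOn (length xs) (val xs) → IsPermᵛ (length xs) (st xs)
st-IsPermᵛ xs inj = record { length≡ = length-map _ xs ; bounded = rng ; injective = inj' }
  where
  rng : MapsInto (length xs) (length xs) (val (st xs))
  rng i o q = subst (λ x → 1 ≤ x × x ≤ length xs) (sym (val-st xs i o q)) (s≤s z≤n , countBelow<length xs (val∈ xs i o q))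
  inj' : InjectiveOn (length xs) (val (st xs))
  inj' i j o q o' q' e with <-cmp (val xs i) (val xs j)
  ... | tri< a _ _ = ⊥-elim (<-irrefl e (st-< xs i j o q o' q' a))
  ... | tri≈ _ b _ = inj i j o q o' q' b
  ... | tri> _ _ c = ⊥-elim (<-irrefl (sym e) (st-< xs j i o' q' o q c))

take-injective : ∀ n σ i0 → InjectiveOn n (val σ) → i0 ≤ n → InjectiveOn i0 (val (take i0 σ))
take-injective n σ i0 inj le i j o q o' q' e = inj i j o (≤-trans q le) o' (≤-trans q' le) (trans (sym (val-take i0 σ i q)) (trans e (val-take i0 σ j q')))

drop-injective : ∀ n σ c → InjectiveOn n (val σ) → InjectiveOn (n ∸ c) (val (drop c σ))
drop-injective n σ c inj (suc i) (suc j) o q o' q' e = +-cancelˡ-≡ c _ _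
  (inj (c + suc i) (c + suc j) (≤-trans o (m≤n+m _ c)) (bd q) (≤-trans o' (m≤n+m _ c)) (bd q') (trans (sym (val-drop c σ i)) (trans e (val-drop c σ j))))
  where
  bd : ∀ {x} → suc x ≤ n ∸ c → c + suc x ≤ n
  bd {x} h = subst (c + suc x ≤_) (m+[n∸m]≡n {c} {n} (<⇒≤ (m∸n≢0⇒n<m {n} {c} (λ z → n≮0 (subst (suc x ≤_) z h))))) (+-monoʳ-≤ c h)

module Halves {m : ℕ} {σ : List ℕ} (σ-perm : IsPermᵛ (suc m) σ) {i0 : ℕ} (i0≤m : i0 ≤ m) where

  prefix suffix : List ℕ
  prefix = take i0 σ
  suffix = drop (suc i0) σ

  length-prefix : length prefix ≡ i0
  length-prefix = length-take-≤ i0 σ (subst (i0 ≤_) (sym (length≡ σ-perm)) (≤-trans i0≤m (n≤1+n m)))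

  length-suffix : length suffix ≡ m ∸ i0
  length-suffix = trans (length-drop (suc i0) σ) (cong (_∸ suc i0) (length≡ σ-perm))

  st-prefix : IsPermᵛ i0 (st prefix)
  st-prefix = subst (λ k → IsPermᵛ k (st prefix)) length-prefix (st-IsPermᵛ prefix
    (subst (λ k → InjectiveOn k (val prefix)) (sym length-prefix) (take-injective (suc m) σ i0 (injective σ-perm) (≤-trans i0≤m (n≤1+n m)))))

  st-suffix : IsPermᵛ (m ∸ i0) (st suffix)
  st-suffix = subst (λ k → IsPermᵛ k (st suffix)) length-suffix (st-IsPermᵛ suffix
    (subst (λ k → InjectiveOn k (val suffix)) (sym length-suffix) (drop-injective (suc m) σ (suc i0) (injective σ-perm))))

  private
    in-prefix : ∀ {i} → i ≤ i0 → i ≤ length prefix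
    in-prefix = subst (_ ≤_) (sym length-prefix)
    in-suffix : ∀ {i} → i ≤ m ∸ i0 → i ≤ length suffix
    in-suffix = subst (_ ≤_) (sym length-suffix)

  prefix-< : ∀ {i j} → 1 ≤ i → i ≤ i0 → 1 ≤ j → j ≤ i0 → val σ i < val σ j → val (st prefix) i < val (st prefix) j
  prefix-< {i} {j} o q o' q' lt = st-< prefix i j o (in-prefix q) o' (in-prefix q') (subst₂ _<_ (sym (val-take i0 σ i q)) (sym (val-take i0 σ j q')) lt)

  prefix-<⁻ : ∀ {i j} → 1 ≤ i → i ≤ i0 → 1 ≤ j → j ≤ i0 → val (st prefix) i < val (st prefix) j → val σ i < val σ j
  prefix-<⁻ {i} {j} o q o' q' lt = subst₂ _<_ (val-take i0 σ i q) (val-take i0 σ j q') (st-<⁻ prefix i j o (in-prefix q) o' (in-prefix q') lt)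

  suffix-< : ∀ {i j} → 1 ≤ i → i ≤ m ∸ i0 → 1 ≤ j → j ≤ m ∸ i0 → val σ (suc i0 + i) < val σ (suc i0 + j) → val (st suffix) i < val (st suffix) j
  suffix-< {suc i} {suc j} o q o' q' lt = st-< suffix (suc i) (suc j) o (in-suffix q) o' (in-suffix q') (subst₂ _<_ (sym (val-drop (suc i0) σ i)) (sym (val-drop (suc i0) σ j)) lt)

  suffix-<⁻ : ∀ {i j} → 1 ≤ i → i ≤ m ∸ i0 → 1 ≤ j → j ≤ m ∸ i0 → val (st suffix) i < val (st suffix) j → val σ (suc i0 + i) < val σ (suc i0 + j)
  suffix-<⁻ {suc i} {suc j} o q o' q' lt = subst₂ _<_ (val-drop (suc i0) σ i) (val-drop (suc i0) σ j) (st-<⁻ suffix (suc i) (suc j) o (in-suffix q) o' (in-suffix q') lt)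

-- The map λ
≡ᵇ-refl : ∀ x → (x ≡ᵇ x) ≡ true
≡ᵇ-refl zero = refl
≡ᵇ-refl (suc x) = ≡ᵇ-refl x

≢⇒≡ᵇ≡false : ∀ m x → x ≢ m → (m ≡ᵇ x) ≡ false
≢⇒≡ᵇ≡false m x ne with m ≡ᵇ x in eq
... | true = ⊥-elim (ne (sym (≡ᵇ⇒≡ m x (Equivalence.from T-≡ eq))))
... | false = refl

splitAtVal-first : ∀ m σ i0 → suc i0 ≤ length σ → val σ (suc i0) ≡ m → (∀ p → 1 ≤ p → p ≤ i0 → val σ p ≢ m) → splitAtVal m σ ≡ (take i0 σ , drop (suc i0) σ)
splitAtVal-first m (x ∷ σ) zero _ refl _ rewrite ≡ᵇ-refl x = refl
splitAtVal-first m (x ∷ σ) (suc i0) (s≤s q) e ne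
  rewrite ≢⇒≡ᵇ≡false m x (ne 1 (s≤s z≤n) (s≤s z≤n))
        | splitAtVal-first m σ i0 q e (λ p o pq h → ne (suc p) (s≤s z≤n) (s≤s pq) (trans (val-cons x σ p o) h)) = refl

lamF-split : ∀ k x xs a b → splitAtVal (length (x ∷ xs)) (x ∷ xs) ≡ (a , b) → lamF (suc k) (x ∷ xs) ≡ (lamF k (st a) ∨T lamF k (st b))
lamF-split k x xs a b eq rewrite eq = refl

-- subtreeStart T j ∸ 1 is the last position before j holding a larger value (or 0 if there is none).
StartsAfterPreviousGreater : Tree → (ℕ → ℕ) → Set
StartsAfterPreviousGreater T f = ∀ j → 1 ≤ j → j ≤ size T →
  (∀ i → subtreeStart T j ≤ i → i < j → f i < f j) × (2 ≤ subtreeStart T j → f j < f (subtreeStart T j ∸ 1))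

previousGreater-transport : ∀ {T} (g f : ℕ → ℕ) → (∀ {i j} → 1 ≤ i → i ≤ size T → 1 ≤ j → j ≤ size T → g i < g j → f i < f j) →
  StartsAfterPreviousGreater T g → StartsAfterPreviousGreater T f
previousGreater-transport {T} g f g⇒f sT j o q =
    (λ i s≤i i<j → g⇒f (≤-trans (subtreeStart≥1 T j) s≤i) (≤-trans (<⇒≤ i<j) q) o q (proj₁ (sT j o q) i s≤i i<j))
  , (λ 2≤s → g⇒f o q (pred-≥1 2≤s) (≤-trans (∸-monoˡ-≤ 1 (subtreeStart≤ T j o q)) (≤-trans (m∸n≤m j 1) q)) (proj₂ (sT j o q) 2≤s))
  where
  pred-≥1 : ∀ {x} → 2 ≤ x → 1 ≤ x ∸ 1
  pred-≥1 (s≤s (s≤s _)) = s≤s z≤n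

previousGreater-∨T : ∀ L R (f : ℕ → ℕ) → StartsAfterPreviousGreater L f → StartsAfterPreviousGreater R (λ i → f (suc (size L) + i)) →
  (∀ i → 1 ≤ i → i ≤ size (L ∨T R) → i ≢ suc (size L) → f i < f (suc (size L))) →
  StartsAfterPreviousGreater (L ∨T R) f
previousGreater-∨T L R f sL sR root-max j o q with position (size L) j
... | inLeft qj = sL j o qj
... | atRoot refl = (λ i h ij → root-max i h (≤-trans (<⇒≤ ij) q) (λ e → <-irrefl e ij)) , (λ { (s≤s ()) })
... | inRight j' refl = inside , before-subtree
  where
  K : ℕ
  K = suc (size L)
  s : ℕ
  s = subtreeStart R (suc j')
  qR : suc j' ≤ size R
  qR = +-cancelˡ-≤ (size L) _ _ (≤-pred q)
  inside : ∀ i → K + s ≤ i → i < K + suc j' → f i < f (K + suc j')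
  inside i h ij = subst (λ z → f z < f (K + suc j')) i≡ (proj₁ (sR (suc j') (s≤s z≤n) qR) (i ∸ K) s≤i' i'<)
    where
    i≡ : K + (i ∸ K) ≡ i
    i≡ = m+[n∸m]≡n (≤-trans (m≤m+n K _) h)
    s≤i' : s ≤ i ∸ K
    s≤i' = +-cancelˡ-≤ K _ _ (subst (K + s ≤_) (sym i≡) h)
    i'< : i ∸ K < suc j'
    i'< = +-cancelˡ-< K _ _ (subst (_< K + suc j') (sym i≡) ij)
  before-subtree : 2 ≤ K + s → f (K + suc j') < f (K + s ∸ 1)
  before-subtree _ with s | proj₂ (sR (suc j') (s≤s z≤n) qR) | subtreeStart≥1 R (suc j')
  ... | suc zero | _ | _ = subst (λ z → f (K + suc j') < f z) (sym (m+n∸n≡m K 1)) (root-max (K + suc j') (s≤s z≤n) q (inRight≢atRoot (size L) j'))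
  ... | suc (suc x) | earlier | _ = subst (λ z → f (K + suc j') < f z) (sym (+-∸-assoc K {suc (suc x)} {1} (s≤s z≤n))) (earlier (s≤s (s≤s z≤n)))

lamF-spec : ∀ k n σ → IsPermᵛ n σ → n ≤ k → (size (lamF k σ) ≡ n) × StartsAfterPreviousGreater (lamF k σ) (val σ)
lamF-spec zero n σ d q rewrite n≤0⇒n≡0 q = refl , λ j o q' → ⊥-elim (n≮0 (≤-trans o q'))
lamF-spec (suc k) n [] d q rewrite sym (length≡ d) = refl , λ j o q' → ⊥-elim (n≮0 (≤-trans o q'))
lamF-spec (suc k) n (x ∷ xs) d q with length≡ d
... | refl with maxPosition (length xs) (x ∷ xs) d
...   | i0 , i0≤m , σi0≡max =
  subst (λ T → (size T ≡ suc m) × StartsAfterPreviousGreater T (val σ)) (sym (lamF-split k x xs prefix suffix split≡))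
    (size≡ , previousGreater-∨T Tₗ Tᵣ (val σ) specL specR root-max)
  where
  m : ℕ
  m = length xs
  σ : List ℕ
  σ = x ∷ xs
  open Halves d i0≤m
  below-max : ∀ i → 1 ≤ i → i ≤ suc m → i ≢ suc i0 → val σ i < suc m
  below-max i o i≤ i≢ = ≤∧≢⇒< (proj₂ (bounded d i o i≤)) (λ h → i≢ (injective d i (suc i0) o i≤ (s≤s z≤n) (s≤s i0≤m) (trans h (sym σi0≡max))))
  split≡ : splitAtVal (suc m) σ ≡ (prefix , suffix)
  split≡ = splitAtVal-first (suc m) σ i0 (s≤s i0≤m) σi0≡max
    (λ p o p≤ h → <-irrefl h (below-max p o (≤-trans p≤ (≤-trans i0≤m (n≤1+n m))) (λ e → 1+n≰n (subst (_≤ i0) e p≤))))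
  ihL : (size (lamF k (st prefix)) ≡ i0) × StartsAfterPreviousGreater (lamF k (st prefix)) (val (st prefix))
  ihL = lamF-spec k i0 (st prefix) st-prefix (≤-trans i0≤m (≤-pred q))
  ihR : (size (lamF k (st suffix)) ≡ m ∸ i0) × StartsAfterPreviousGreater (lamF k (st suffix)) (val (st suffix))
  ihR = lamF-spec k (m ∸ i0) (st suffix) st-suffix (≤-trans (m∸n≤m m i0) (≤-pred q))
  Tₗ Tᵣ : Tree
  Tₗ = lamF k (st prefix)
  Tᵣ = lamF k (st suffix)
  size≡ : suc (size Tₗ + size Tᵣ) ≡ suc m
  size≡ = cong suc (trans (cong₂ _+_ (proj₁ ihL) (proj₁ ihR)) (m+[n∸m]≡n i0≤m))
  specL : StartsAfterPreviousGreater Tₗ (val σ)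
  specL = previousGreater-transport (val (st prefix)) (val σ)
    (λ o q o' q' → prefix-<⁻ o (subst (_ ≤_) (proj₁ ihL) q) o' (subst (_ ≤_) (proj₁ ihL) q')) (proj₂ ihL)
  specR : StartsAfterPreviousGreater Tᵣ (λ i → val σ (suc (size Tₗ) + i))
  specR = subst (λ z → StartsAfterPreviousGreater Tᵣ (λ i → val σ (suc z + i))) (sym (proj₁ ihL))
    (previousGreater-transport (val (st suffix)) _
      (λ o q o' q' → suffix-<⁻ o (subst (_ ≤_) (proj₁ ihR) q) o' (subst (_ ≤_) (proj₁ ihR) q')) (proj₂ ihR))
  root-max : ∀ i → 1 ≤ i → i ≤ size (Tₗ ∨T Tᵣ) → i ≢ suc (size Tₗ) → val σ i < val σ (suc (size Tₗ))
  root-max i o i≤ i≢ = subst (λ z → val σ i < val σ (suc z)) (sym (proj₁ ihL))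
    (subst (val σ i <_) (sym σi0≡max) (below-max i o (subst (i ≤_) size≡ i≤) (λ e → i≢ (trans e (cong suc (sym (proj₁ ihL)))))))

GDesᵛ : List ℕ → ℕ → ℕ → Set
GDesᵛ σ n p = ∀ i m → 1 ≤ i → i ≤ p → p < m → m ≤ n → val σ m < val σ i

firstTrue-spec : ∀ (f : ℕ → Bool) (g : ℕ → ℕ) m d →
  (Σ ℕ λ i → (i < m) × (firstTrue f (applyUpTo g m) d ≡ g i) × (f (g i) ≡ true) × (∀ i' → i' < i → f (g i') ≡ false))
  ⊎ ((firstTrue f (applyUpTo g m) d ≡ d) × (∀ i' → i' < m → f (g i') ≡ false))
firstTrue-spec f g zero d = inj₂ (refl , λ i' ())
firstTrue-spec f g (suc m) d with f (g 0) in eq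
... | true = inj₁ (0 , s≤s z≤n , refl , eq , λ i' ())
... | false with firstTrue-spec f (λ i → g (suc i)) m d
...   | inj₁ (i , i< , r , t , bf) = inj₁ (suc i , s≤s i< , r , t , bf')
  where
  bf' : ∀ i' → i' < suc i → f (g i') ≡ false
  bf' zero _ = eq
  bf' (suc i') (s≤s h) = bf i' h
...   | inj₂ (r , bf) = inj₂ (r , bf')
  where
  bf' : ∀ i' → i' < suc m → f (g i') ≡ false
  bf' zero _ = eq
  bf' (suc i') (s≤s h) = bf i' h

allB-sound : ∀ (h : ℕ → Bool) xs → allB h xs ≡ true → ∀ i → 1 ≤ i → i ≤ length xs → h (val xs i) ≡ true
allB-sound h [] e i o q = ⊥-elim (n≮0 (≤-trans o q))
allB-sound h (x ∷ xs) e i o q with h x in eq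
allB-sound h (x ∷ xs) e (suc zero) o q | true = eq
allB-sound h (x ∷ xs) e (suc (suc i)) o (s≤s q) | true = allB-sound h xs e (suc i) (s≤s z≤n) q
allB-sound h (x ∷ xs) () i o q | false

allB-complete : ∀ (h : ℕ → Bool) xs → (∀ i → 1 ≤ i → i ≤ length xs → h (val xs i) ≡ true) → allB h xs ≡ true
allB-complete h [] H = refl
allB-complete h (x ∷ xs) H with h x in eq
... | true = allB-complete h xs (λ { (suc i) o q → H (suc (suc i)) (s≤s z≤n) (s≤s q) })
... | false = trans (sym eq) (H 1 (s≤s z≤n) (s≤s z≤n))

isGDesB-sound : ∀ σ p → p ≤ length σ → isGDesB σ p ≡ true → ∀ i → 1 ≤ i → i ≤ p → length σ ∸ p < val σ i
isGDesB-sound σ p pl e i o q = subst (length σ ∸ p <_) (val-take p σ i q)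
  (<ᵇ⇒< _ _ (Equivalence.from T-≡ (allB-sound (λ x → (length σ ∸ p) <ᵇ x) (take p σ) e i o (subst (i ≤_) (sym (length-take-≤ p σ pl)) q))))

isGDesB-complete : ∀ σ p → p ≤ length σ → (∀ i → 1 ≤ i → i ≤ p → length σ ∸ p < val σ i) → isGDesB σ p ≡ true
isGDesB-complete σ p pl H = allB-complete (λ x → (length σ ∸ p) <ᵇ x) (take p σ) λ i o q →
  let q' = subst (i ≤_) (length-take-≤ p σ pl) q in
  Equivalence.to T-≡ (subst (λ z → T ((length σ ∸ p) <ᵇ z)) (sym (val-take p σ i q')) (<⇒<ᵇ (H i o q')))

pigeonhole-shifted : ∀ k lw M (f : ℕ → ℕ) → (∀ i → 1 ≤ i → i ≤ k → suc lw ≤ f i × f i ≤ lw + M) → InjectiveOn k f → k ≤ M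
pigeonhole-shifted k lw M f r inj = pigeonhole k M (λ i → f i ∸ lw) rng inj'
  where
  rng : MapsInto k M (λ i → f i ∸ lw)
  rng i o q = m+n≤o⇒m≤o∸n 1 (proj₁ (r i o q)) , subst (f i ∸ lw ≤_) (m+n∸m≡n lw M) (∸-monoˡ-≤ lw (proj₂ (r i o q)))
  inj' : InjectiveOn k (λ i → f i ∸ lw)
  inj' i j o q o' q' e = inj i j o q o' q'
    (trans (sym (m∸n+n≡m (≤-trans (n≤1+n lw) (proj₁ (r i o q))))) (trans (cong (_+ lw) e) (m∸n+n≡m (≤-trans (n≤1+n lw) (proj₁ (r j o' q'))))))

TopPrefix : ℕ → List ℕ → ℕ → Set
TopPrefix n σ p = ∀ i → 1 ≤ i → i ≤ p → n ∸ p < val σ i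

GDesᵛ⇒TopPrefix : ∀ n σ p → IsPermᵛ n σ → 1 ≤ p → p < n → GDesᵛ σ n p → TopPrefix n σ p
GDesᵛ⇒TopPrefix n σ p d o pn cg i oi qi = ≤-<-trans (pigeonhole (n ∸ p) (val σ i ∸ 1) (λ m' → val σ (p + m')) rng inj) (∸-1< (proj₁ (bounded d i oi (≤-trans qi (<⇒≤ pn)))))
  where
  ∸-1< : ∀ {v} → 1 ≤ v → v ∸ 1 < v
  ∸-1< {suc v} _ = ≤-refl
  bd : ∀ {m'} → m' ≤ n ∸ p → p + m' ≤ n
  bd h = subst (_ ≤_) (m+[n∸m]≡n (<⇒≤ pn)) (+-monoʳ-≤ p h)
  rng : MapsInto (n ∸ p) (val σ i ∸ 1) (λ m' → val σ (p + m'))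
  rng m' o' q' = proj₁ (bounded d (p + m') (≤-trans o' (m≤n+m _ p)) (bd q')) ,
     m+n≤o⇒m≤o∸n (val σ (p + m')) (subst (_≤ val σ i) (+-comm 1 _) (cg i (p + m') oi qi (subst (_≤ p + m') (+-comm p 1) (+-monoʳ-≤ p o')) (bd q')))
  inj : InjectiveOn (n ∸ p) (λ m' → val σ (p + m'))
  inj a b oa qa ob qb e = +-cancelˡ-≡ p _ _ (injective d (p + a) (p + b) (≤-trans oa (m≤n+m _ p)) (bd qa) (≤-trans ob (m≤n+m _ p)) (bd qb) e)

TopPrefix⇒suffixLow : ∀ n σ p → IsPermᵛ n σ → p ≤ n → TopPrefix n σ p →
  ∀ m' → p < m' → m' ≤ n → val σ m' ≤ n ∸ p
TopPrefix⇒suffixLow n σ p d p≤n high m' pm mn with val σ m' ≤? n ∸ p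
... | yes low = low
... | no m'-high = ⊥-elim (1+n≰n (pigeonhole-shifted (suc p) (n ∸ p) p (λ i → val σ (pick i)) pick-high pick-injective))
  where
  pick : ℕ → ℕ
  pick i with i ≤? p
  ... | yes _ = i
  ... | no _ = m'
  n≡ : n ∸ p + p ≡ n
  n≡ = m∸n+n≡m p≤n
  pick-high : ∀ i → 1 ≤ i → i ≤ suc p → suc (n ∸ p) ≤ val σ (pick i) × val σ (pick i) ≤ n ∸ p + p
  pick-high i o q with i ≤? p
  ... | yes i≤p = high i o i≤p , subst (val σ i ≤_) (sym n≡) (proj₂ (bounded d i o (≤-trans i≤p p≤n)))
  ... | no _ = ≰⇒> m'-high , subst (val σ m' ≤_) (sym n≡) (proj₂ (bounded d m' (≤-trans (s≤s z≤n) pm) mn))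
  pick-position : ∀ i → 1 ≤ i → i ≤ suc p → (1 ≤ pick i) × (pick i ≤ n)
  pick-position i o q with i ≤? p
  ... | yes i≤p = o , ≤-trans i≤p p≤n
  ... | no _ = ≤-trans (s≤s z≤n) pm , mn
  pick-cases : ∀ i j → i ≤ suc p → j ≤ suc p → pick i ≡ pick j → i ≡ j
  pick-cases i j qi qj e with i ≤? p | j ≤? p
  ... | yes _   | yes _   = e
  ... | yes i≤p | no _    = ⊥-elim (<⇒≱ pm (subst (_≤ p) e i≤p))
  ... | no _    | yes j≤p = ⊥-elim (<⇒≱ pm (subst (_≤ p) (sym e) j≤p))
  ... | no i≰p  | no j≰p  = trans (≤-antisym qi (≰⇒> i≰p)) (sym (≤-antisym qj (≰⇒> j≰p)))
  pick-injective : InjectiveOn (suc p) (λ i → val σ (pick i))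
  pick-injective i j oi qi oj qj e = pick-cases i j qi qj
    (injective d (pick i) (pick j) (proj₁ (pick-position i oi qi)) (proj₂ (pick-position i oi qi))
                                   (proj₁ (pick-position j oj qj)) (proj₂ (pick-position j oj qj)) e)

isGDesB⇒GDesᵛ : ∀ n σ p → IsPermᵛ n σ → p < n → isGDesB σ p ≡ true → GDesᵛ σ n p
isGDesB⇒GDesᵛ n σ p d pn e i m' oi qi pm mn = ≤-<-trans (TopPrefix⇒suffixLow n σ p d (<⇒≤ pn) H m' pm mn) (H i oi qi)
  where
  H : TopPrefix n σ p
  H = subst (λ z → ∀ i → 1 ≤ i → i ≤ p → z ∸ p < val σ i) (length≡ d) (isGDesB-sound σ p (subst (p ≤_) (sym (length≡ d)) (<⇒≤ pn)) e)

GDesᵛ⇒isGDesB : ∀ n σ p → IsPermᵛ n σ → 1 ≤ p → p < n → GDesᵛ σ n p → isGDesB σ p ≡ true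
GDesᵛ⇒isGDesB n σ p d o pn cg = isGDesB-complete σ p (subst (p ≤_) (sym (length≡ d)) (<⇒≤ pn))
  (subst (λ z → ∀ i → 1 ≤ i → i ≤ p → z ∸ p < val σ i) (sym (length≡ d)) (GDesᵛ⇒TopPrefix n σ p d o pn cg))

-- The map ρ
record RhoCut (n : ℕ) (σ : List ℕ) (j0 : ℕ) : Set where
  field
    1≤cut       : 1 ≤ j0
    cut≤n       : j0 ≤ n
    cut-isGDes  : j0 < n → GDesᵛ σ n j0
    cut-minimal : ∀ p → 1 ≤ p → p < j0 → ¬ GDesᵛ σ n p

false≢true : false ≢ true
false≢true ()

rhoJ-spec : ∀ n σ → IsPermᵛ n σ → 1 ≤ n → RhoCut n σ (rhoJ σ)
rhoJ-spec n σ d o with firstTrue-spec (isGDesB σ) suc (length σ ∸ 1) (length σ)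
... | inj₁ (i , i< , r , t , bf) = subst (RhoCut n σ) (sym r) record
  { 1≤cut       = s≤s z≤n
  ; cut≤n       = sn
  ; cut-isGDes  = λ h → isGDesB⇒GDesᵛ n σ (suc i) d h t
  ; cut-minimal = λ { (suc p) _ (s≤s pq) cg → false≢true (trans (sym (bf p pq)) (GDesᵛ⇒isGDesB n σ (suc p) d (s≤s z≤n) (≤-trans (s≤s pq) sn) cg)) } }
  where
  sn : suc i ≤ n
  sn = ≤-trans i< (≤-trans (m∸n≤m _ 1) (≤-reflexive (length≡ d)))
... | inj₂ (r , bf) = subst (RhoCut n σ) (sym (trans r (length≡ d))) record
  { 1≤cut       = o
  ; cut≤n       = ≤-refl
  ; cut-isGDes  = λ h → ⊥-elim (<-irrefl refl h)
  ; cut-minimal = λ { (suc p) _ pq cg → false≢true (trans (sym (bf p (lt pq))) (GDesᵛ⇒isGDesB n σ (suc p) d (s≤s z≤n) pq cg)) } }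
  where
  lt : ∀ {p} → suc p < n → p < length σ ∸ 1
  lt {p} h = subst (λ z → p < z ∸ 1) (sym (length≡ d)) (lt' n h)
    where
    lt' : ∀ n → suc p < n → p < n ∸ 1
    lt' (suc n) (s≤s h) = h

-- By gam-compare, the pairs i < j with i < subtreeStart T j are exactly the inversions of gam T.
InversionsBelow : Tree → (ℕ → ℕ) → ℕ → Set
InversionsBelow T f n = ∀ i j → 1 ≤ i → i < j → j ≤ n → i < subtreeStart T j → f j < f i

GreatestBelow : Tree → (ℕ → ℕ) → ℕ → Set
GreatestBelow T f n = ∀ t → size t ≡ n → InversionsBelow t f n → t ≤T T

RhoSpec : ℕ → ℕ → List ℕ → Set
RhoSpec k n σ = (size (rhoF k σ) ≡ n) × InversionsBelow (rhoF k σ) (val σ) n × GreatestBelow (rhoF k σ) (val σ) n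

rhoF-split : ∀ k x xs j0 → rhoJ (x ∷ xs) ≡ j0 → rhoF (suc k) (x ∷ xs) ≡ (rhoF k (st (take (j0 ∸ 1) (x ∷ xs))) ∨T rhoF k (st (drop j0 (x ∷ xs))))
rhoF-split k x xs j0 eq rewrite eq = refl

inversionsBelow-transport : ∀ {n} T (g f : ℕ → ℕ) → (∀ {i j} → 1 ≤ i → i ≤ n → 1 ≤ j → j ≤ n → g i < g j → f i < f j) →
  InversionsBelow T g n → InversionsBelow T f n
inversionsBelow-transport T g f g⇒f inv i j o i<j j≤n h = g⇒f o′ j≤n o (≤-trans (<⇒≤ i<j) j≤n) (inv i j o i<j j≤n h)
  where o′ = ≤-trans o (<⇒≤ i<j)

greatestBelow-transport : ∀ {T n} (g f : ℕ → ℕ) → (∀ {i j} → 1 ≤ i → i ≤ n → 1 ≤ j → j ≤ n → f i < f j → g i < g j) →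
  GreatestBelow T g n → GreatestBelow T f n
greatestBelow-transport g f f⇒g greatest t size≡ inv = greatest t size≡ (inversionsBelow-transport t f g f⇒g inv)

inversionsBelow-∨T : ∀ {n i0} σ L R → size L ≡ i0 → size (L ∨T R) ≡ n → (suc i0 < n → GDesᵛ σ n (suc i0)) →
  InversionsBelow L (val σ) i0 → InversionsBelow R (λ i → val σ (suc i0 + i)) (size R) → InversionsBelow (L ∨T R) (val σ) n
inversionsBelow-∨T {n} σ L R refl size≡ cut invL invR i j o ij jn h with position (size L) j
... | inLeft qj = invL i j o ij qj h
... | atRoot refl = ⊥-elim (<⇒≱ h o)
... | inRight j' refl with i ≤? suc (size L)
...   | yes i≤cut = cut (<-≤-trans K<j jn) i j o i≤cut K<j jn
  where
  K<j : suc (size L) < suc (size L) + suc j'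
  K<j = m<m+n (suc (size L)) (s≤s z≤n)
...   | no i≰cut = subst (λ z → val σ (K + suc j') < val σ z) i≡ (invR (suc i') (suc j') (s≤s z≤n) i'<j' j'≤ h')
  where
  K : ℕ
  K = suc (size L)
  i' : ℕ
  i' = i ∸ suc K
  i≡ : K + suc i' ≡ i
  i≡ = trans (+-suc K i') (m+[n∸m]≡n (≰⇒> i≰cut))
  i'<j' : suc i' < suc j'
  i'<j' = +-cancelˡ-< K _ _ (subst (_< K + suc j') (sym i≡) ij)
  j'≤ : suc j' ≤ size R
  j'≤ = +-cancelˡ-≤ (size L) _ _ (≤-pred (subst (_ ≤_) (sym size≡) jn))
  h' : suc i' < subtreeStart R (suc j')
  h' = +-cancelˡ-< K _ _ (subst (_< K + subtreeStart R (suc j')) (sym i≡) h)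

inversionsBelow-raised : ∀ {t n f i0} (r : RaisedRoot t (suc i0)) → suc i0 ≤ n → InversionsBelow t f n →
  InversionsBelow (RaisedRoot.leftPart r) f i0 × InversionsBelow (RaisedRoot.rightPart r) (λ i → f (suc i0 + i)) (n ∸ suc i0)
inversionsBelow-raised {t} {n} {f} {i0} r cut≤n inv = invL , invR
  where
  open RaisedRoot r
  invL : InversionsBelow leftPart f i0
  invL i j o ij qj h = inv i j o ij (≤-trans qj (≤-trans (n≤1+n i0) cut≤n)) (subst (i <_) (start-leftPart j (s≤s qj)) h)
  invR : InversionsBelow rightPart (λ i → f (suc i0 + i)) (n ∸ suc i0)
  invR (suc i') (suc j') o ij qj h = inv (suc i0 + suc i') (suc i0 + suc j') (s≤s z≤n) (+-monoʳ-< (suc i0) ij) jn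
    (<⊔⇒< (subst (suc i0 + suc i' <_) (start-rightPart j') (+-monoʳ-< (suc i0) h)) (λ z → <⇒≱ z (m<m+n (suc i0) (s≤s z≤n))))
    where
    jn : suc i0 + suc j' ≤ n
    jn = subst (_ ≤_) (m+[n∸m]≡n cut≤n) (+-monoʳ-≤ (suc i0) qj)

subtreeStart-at-cut : ∀ {n σ j0} t → RhoCut n σ j0 → size t ≡ n → InversionsBelow t (val σ) n → subtreeStart t j0 ≡ 1
subtreeStart-at-cut {n} {σ} {j0} t cut size≡ inv with subtreeStart t j0 in start≡ | subtreeStart≥1 t j0
... | zero | ()
... | suc zero | _ = refl
... | suc (suc p) | _ = ⊥-elim (cut-minimal (suc p) (s≤s z≤n) p<j0 earlier)
  where
  open RhoCut cut
  j0≤t : j0 ≤ size t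
  j0≤t = subst (j0 ≤_) (sym size≡) cut≤n
  p<j0 : suc p < j0
  p<j0 = subst (_≤ j0) start≡ (subtreeStart≤ t j0 1≤cut j0≤t)
  earlier : GDesᵛ σ n (suc p)
  earlier i k oi ip pk kn with k ≤? j0
  ... | no k≰j0 = cut-isGDes (<-≤-trans (≰⇒> k≰j0) kn) i k oi (≤-trans ip (<⇒≤ p<j0)) (≰⇒> k≰j0) kn
  ... | yes k≤j0 = inv i k oi (≤-<-trans ip pk) kn (<-≤-trans (s≤s ip) start≤)
    where
    start≤ : suc (suc p) ≤ subtreeStart t k
    start≤ with m≤n⇒m<n∨m≡n k≤j0
    ... | inj₁ k<j0 = subst (_≤ subtreeStart t k) start≡ (subtreeStart-nested t j0 k j0≤t (subst (_≤ k) (sym start≡) pk) k<j0)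
    ... | inj₂ refl = ≤-reflexive (sym start≡)

greatestBelow-∨T : ∀ {m i0} σ L R → size L ≡ i0 → RhoCut (suc m) σ (suc i0) →
  GreatestBelow L (val σ) i0 → GreatestBelow R (λ i → val σ (suc i0 + i)) (m ∸ i0) → GreatestBelow (L ∨T R) (val σ) (suc m)
greatestBelow-∨T {m} {i0} σ L R refl cut greatestL greatestR t size≡ inv =
  raised ◅◅ ∨T-mono (greatestL leftPart size-leftPart′ (proj₁ invs)) (greatestR rightPart size-rightPart (proj₂ invs))
  where
  r : RaisedRoot t (suc i0)
  r = raiseRoot t (suc i0) (s≤s z≤n) (subst (_ ≤_) (sym size≡) (RhoCut.cut≤n cut)) (subtreeStart-at-cut t cut size≡ inv)
  open RaisedRoot r
  invs : InversionsBelow leftPart (val σ) i0 × InversionsBelow rightPart (λ i → val σ (suc i0 + i)) (m ∸ i0)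
  invs = inversionsBelow-raised r (RhoCut.cut≤n cut) inv
  size-leftPart′ : size leftPart ≡ i0
  size-leftPart′ = suc-injective size-leftPart
  size-rightPart : size rightPart ≡ m ∸ i0
  size-rightPart = trans (sym (m+n∸m≡n i0 (size rightPart)))
    (cong (_∸ i0) (suc-injective (trans (sym (trans size≡-raised (cong (λ z → suc (z + size rightPart)) size-leftPart′))) size≡)))

leaf-rhoSpec : ∀ f → (size leaf ≡ 0) × InversionsBelow leaf f 0 × GreatestBelow leaf f 0
leaf-rhoSpec f = refl , (λ i j o ij jn _ → ⊥-elim (n≮0 (≤-trans ij jn))) , (λ t t-size _ → subst (_≤T leaf) (sym (size≡0⇒leaf t t-size)) ε)

rhoF-spec : ∀ k n σ → IsPermᵛ n σ → n ≤ k → RhoSpec k n σ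
rhoF-spec zero n σ d q rewrite n≤0⇒n≡0 q = leaf-rhoSpec (val σ)
rhoF-spec (suc k) n [] d q rewrite sym (length≡ d) = leaf-rhoSpec (val [])
rhoF-spec (suc k) n (x ∷ xs) d q with length≡ d
... | refl = subst (λ T → (size T ≡ suc m) × InversionsBelow T (val σ) (suc m) × GreatestBelow T (val σ) (suc m)) (sym rhoF≡)
               (size≡ , inversions , greatest)
  where
  m : ℕ
  m = length xs
  σ : List ℕ
  σ = x ∷ xs
  cut : RhoCut (suc m) σ (rhoJ σ)
  cut = rhoJ-spec (suc m) σ d (s≤s z≤n)
  i0 : ℕ
  i0 = rhoJ σ ∸ 1
  cut≡ : suc i0 ≡ rhoJ σ
  cut≡ = suc[n∸1]≡n (RhoCut.1≤cut cut)
  cut′ : RhoCut (suc m) σ (suc i0)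
  cut′ = subst (RhoCut (suc m) σ) (sym cut≡) cut
  i0≤m : i0 ≤ m
  i0≤m = ≤-pred (RhoCut.cut≤n cut′)
  open Halves d i0≤m
  rhoF≡ : rhoF (suc k) σ ≡ (rhoF k (st prefix) ∨T rhoF k (st suffix))
  rhoF≡ = rhoF-split k x xs (suc i0) (sym cut≡)
  ihL : RhoSpec k i0 (st prefix)
  ihL = rhoF-spec k i0 (st prefix) st-prefix (≤-trans i0≤m (≤-pred q))
  ihR : RhoSpec k (m ∸ i0) (st suffix)
  ihR = rhoF-spec k (m ∸ i0) (st suffix) st-suffix (≤-trans (m∸n≤m m i0) (≤-pred q))
  Tₗ Tᵣ : Tree
  Tₗ = rhoF k (st prefix)
  Tᵣ = rhoF k (st suffix)
  size≡ : size (Tₗ ∨T Tᵣ) ≡ suc m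
  size≡ = cong suc (trans (cong₂ _+_ (proj₁ ihL) (proj₁ ihR)) (m+[n∸m]≡n i0≤m))
  inversions : InversionsBelow (Tₗ ∨T Tᵣ) (val σ) (suc m)
  inversions = inversionsBelow-∨T σ Tₗ Tᵣ (proj₁ ihL) size≡ (RhoCut.cut-isGDes cut′)
    (inversionsBelow-transport Tₗ _ _ prefix-<⁻ (proj₁ (proj₂ ihL)))
    (subst (InversionsBelow Tᵣ _) (sym (proj₁ ihR)) (inversionsBelow-transport Tᵣ _ _ suffix-<⁻ (proj₁ (proj₂ ihR))))
  greatest : GreatestBelow (Tₗ ∨T Tᵣ) (val σ) (suc m)
  greatest = greatestBelow-∨T σ Tₗ Tᵣ (proj₁ ihL) cut′
    (greatestBelow-transport _ _ prefix-< (proj₂ (proj₂ ihL)))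
    (greatestBelow-transport _ _ suffix-< (proj₂ (proj₂ ihR)))

Inv⇒> : ∀ σ {i j} → Inv σ i j → val σ j < val σ i
Inv⇒> _ (_ , _ , _ , lt) = lt

gam-inversion⇒outside : ∀ t {i j} → Inv (gam t) i j → i < subtreeStart t j
gam-inversion⇒outside t {i} {j} (o , ij , jl , lt) with subtreeStart t j ≤? i
... | yes inside = ⊥-elim (<-asym lt (proj₁ (gam-compare t i j o ij (subst (j ≤_) (length-gam t) jl)) inside))
... | no outside = ≰⇒> outside

outside⇒gam-inversion : ∀ t {i j} → 1 ≤ i → i < j → j ≤ size t → i < subtreeStart t j → Inv (gam t) i j
outside⇒gam-inversion t {i} {j} o ij jt outside = o , ij , subst (j ≤_) (sym (length-gam t)) jt , proj₂ (gam-compare t i j o ij jt) outside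

gam-IsPermᵛ : ∀ t → IsPermᵛ (size t) (gam t)
gam-IsPermᵛ t = record { length≡ = length-gam t ; bounded = val-gam-bounded t ; injective = inj }
  where
  distinct : ∀ {i j} → 1 ≤ i → i < j → j ≤ size t → val (gam t) i ≢ val (gam t) j
  distinct {i} {j} o ij jt e with subtreeStart t j ≤? i
  ... | yes inside = <-irrefl e (proj₁ (gam-compare t i j o ij jt) inside)
  ... | no outside = <-irrefl (sym e) (proj₂ (gam-compare t i j o ij jt) (≰⇒> outside))
  inj : InjectiveOn (size t) (val (gam t))
  inj i j o q o' q' e with <-cmp i j
  ... | tri< ij _ _ = ⊥-elim (distinct o ij q' e)
  ... | tri≈ _ i≡j _ = i≡j
  ... | tri> _ _ ji = ⊥-elim (distinct o' ji q (sym e))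

gam-IsPermᵛ′ : ∀ {n} t → size t ≡ n → IsPermᵛ n (gam t)
gam-IsPermᵛ′ t refl = gam-IsPermᵛ t

gam-mono : ∀ {s t} → s ≤T t → gam s ≤W gam t
gam-mono {s} {t} s≤t i j inv@(o , ij , jl , _) =
  outside⇒gam-inversion t o ij (subst (j ≤_) (trans (length-gam s) (≤T-size s≤t)) jl)
    (<-≤-trans (gam-inversion⇒outside s inv) (subtreeStart-mono s≤t j))

subtreeStart-pred-outside⇒≤T : ∀ s t → size s ≡ size t →
  (∀ i j → 1 ≤ i → i < j → j ≤ size t → suc i ≡ subtreeStart s j → i < subtreeStart t j) → s ≤T t
subtreeStart-pred-outside⇒≤T s t e outside = subtreeStart-≤⇒≤T t s e starts≤
  where
  starts≤ : ∀ j → 1 ≤ j → j ≤ size t → subtreeStart s j ≤ subtreeStart t j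
  starts≤ j o jt with subtreeStart s j in start≡ | subtreeStart≥1 s j | subtreeStart≤ s j o (subst (j ≤_) (sym e) jt)
  ... | zero | () | _
  ... | suc zero | _ | _ = subtreeStart≥1 t j
  ... | suc (suc c) | _ | c<j = outside (suc c) j (s≤s z≤n) c<j jt (sym start≡)

gam-reflects-≤ : ∀ s t → size s ≡ size t → gam s ≤W gam t → s ≤T t
gam-reflects-≤ s t e w = subtreeStart-pred-outside⇒≤T s t e λ i j o ij jt i+1≡ →
  gam-inversion⇒outside t (w i j (outside⇒gam-inversion s o ij (subst (j ≤_) (sym e) jt) (≤-reflexive i+1≡)))

lam-size : ∀ {n σ} → IsPermᵛ n σ → size (lam σ) ≡ n
lam-size {n} {σ} d = proj₁ (lamF-spec (length σ) n σ d (≤-reflexive (sym (length≡ d))))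

lam-previousGreater : ∀ {n σ} → IsPermᵛ n σ → StartsAfterPreviousGreater (lam σ) (val σ)
lam-previousGreater {n} {σ} d = proj₂ (lamF-spec (length σ) n σ d (≤-reflexive (sym (length≡ d))))

lam-inversion⇒outside : ∀ {n σ i j} → IsPermᵛ n σ → Inv σ i j → i < subtreeStart (lam σ) j
lam-inversion⇒outside {n} {σ} {i} {j} d (o , ij , jl , lt) with subtreeStart (lam σ) j ≤? i
... | yes inside = ⊥-elim (<-asym lt (proj₁ (lam-previousGreater d j (≤-trans o (<⇒≤ ij)) jλ) i inside ij))
  where
  jλ : j ≤ size (lam σ)
  jλ = subst (j ≤_) (trans (length≡ d) (sym (lam-size d))) jl
... | no outside = ≰⇒> outside

lam⊣gam : ∀ {n σ} t → IsPermᵛ n σ → size t ≡ n → (lam σ ≤T t) ⇔ (σ ≤W gam t)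
lam⊣gam {n} {σ} t d t-size = mk⇔ to from
  where
  to : lam σ ≤T t → σ ≤W gam t
  to λσ≤t i j inv@(o , ij , jl , _) = outside⇒gam-inversion t o ij (subst (j ≤_) (trans (length≡ d) (sym t-size)) jl)
    (<-≤-trans (lam-inversion⇒outside d inv) (subtreeStart-mono λσ≤t j))
  from : σ ≤W gam t → lam σ ≤T t
  from w = subtreeStart-pred-outside⇒≤T (lam σ) t (trans (lam-size d) (sym t-size)) λ i j o ij jt i+1≡ →
    gam-inversion⇒outside t (w i j (o , ij , subst (j ≤_) (trans t-size (sym (length≡ d))) jt , previous-greater o ij jt i+1≡))
    where
    previous-greater : ∀ {i j} → 1 ≤ i → i < j → j ≤ size t → suc i ≡ subtreeStart (lam σ) j → val σ j < val σ i
    previous-greater {i} {j} o ij jt i+1≡ = subst (λ z → val σ j < val σ (z ∸ 1)) (sym i+1≡)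
      (proj₂ (lam-previousGreater d j (≤-trans o (<⇒≤ ij)) (subst (j ≤_) (trans t-size (sym (lam-size d))) jt)) (subst (2 ≤_) i+1≡ (s≤s o)))

rho-spec : ∀ {n σ} → IsPermᵛ n σ → RhoSpec (length σ) n σ
rho-spec {n} {σ} d = rhoF-spec (length σ) n σ d (≤-reflexive (sym (length≡ d)))

rho-size : ∀ {n σ} → IsPermᵛ n σ → size (rho σ) ≡ n
rho-size d = proj₁ (rho-spec d)

gam⊣rho : ∀ {n σ} t → IsPermᵛ n σ → size t ≡ n → (gam t ≤W σ) ⇔ (t ≤T rho σ)
gam⊣rho {n} {σ} t d t-size = mk⇔ to from
  where
  to : gam t ≤W σ → t ≤T rho σ
  to w = proj₂ (proj₂ (rho-spec d)) t t-size λ i j o ij jn outside →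
    Inv⇒> σ (w i j (outside⇒gam-inversion t o ij (subst (j ≤_) (sym t-size) jn) outside))
  from : t ≤T rho σ → gam t ≤W σ
  from t≤ρσ i j inv@(o , ij , jl , _) = o , ij , subst (j ≤_) (sym (length≡ d)) jn ,
    proj₁ (proj₂ (rho-spec d)) i j o ij jn (<-≤-trans (gam-inversion⇒outside t inv) (subtreeStart-mono t≤ρσ j))
    where
    jn : j ≤ n
    jn = subst (j ≤_) (trans (length-gam t) t-size) jl

-- Left-child leaves and descents
length-leafFlags : ∀ b t → length (leafFlags b t) ≡ suc (size t)
length-leafFlags b leaf = refl
length-leafFlags b (l ∨T r) = trans (length-++ (leafFlags true l)) (trans (cong₂ _+_ (length-leafFlags true l) (length-leafFlags false r)) (cong suc (+-suc (size l) (size r))))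

lookupM-++ˡ : ∀ {A : Set} (xs ys : List A) i → i < length xs → lookupM (xs ++ ys) i ≡ lookupM xs i
lookupM-++ˡ (x ∷ xs) ys zero _ = refl
lookupM-++ˡ (x ∷ xs) ys (suc i) (s≤s q) = lookupM-++ˡ xs ys i q

lookupM-++ʳ : ∀ {A : Set} (xs ys : List A) i → lookupM (xs ++ ys) (length xs + i) ≡ lookupM ys i
lookupM-++ʳ [] ys i = refl
lookupM-++ʳ (x ∷ xs) ys i = lookupM-++ʳ xs ys i

leafFlags-first : ∀ t → lookupM (leafFlags true t) 0 ≡ just true
leafFlags-first leaf = refl
leafFlags-first (l ∨T r) = trans (lookupM-++ˡ (leafFlags true l) _ 0 (subst (0 <_) (sym (length-leafFlags true l)) (s≤s z≤n))) (leafFlags-first l)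

leafFlags-last : ∀ t → lookupM (leafFlags false t) (size t) ≡ just false
leafFlags-last leaf = refl
leafFlags-last (l ∨T r) = trans (cong (lookupM (leafFlags true l ++ leafFlags false r)) eq) (trans (lookupM-++ʳ (leafFlags true l) _ (size r)) (leafFlags-last r))
  where
  eq : suc (size l + size r) ≡ length (leafFlags true l) + size r
  eq = cong (_+ size r) (sym (length-leafFlags true l))

leafFlags-lastOfLeft : ∀ l r → 1 ≤ size l → lookupM (leafFlags true l ++ leafFlags false r) (size l) ≡ just false
leafFlags-lastOfLeft leaf r ()
leafFlags-lastOfLeft l@(_ ∨T _) r _ =
  trans (lookupM-++ˡ (leafFlags true l) _ (size l) (subst (size l <_) (sym (length-leafFlags true l)) ≤-refl)) (leafFlags-last l)

LeftChild : Bool → Tree → ℕ → Set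
LeftChild b t p = lookupM (leafFlags b t) p ≡ just true

-- Leaf p, between nodes p and p + 1, is a left child exactly when node p + 1 has an empty left subtree.
leftChild⇔subtreeStart₀ : ∀ r p' → p' < size r →
  (LeftChild false r p' → subtreeStart r (suc p') ≡ suc p') × (subtreeStart r (suc p') ≡ suc p' → LeftChild false r p')

leftChild⇔subtreeStart : ∀ b t p → 1 ≤ p → p < size t →
  (LeftChild b t p → subtreeStart t (suc p) ≡ suc p) × (subtreeStart t (suc p) ≡ suc p → LeftChild b t p)
leftChild⇔subtreeStart b leaf p o ()
leftChild⇔subtreeStart b (l ∨T r) p o q with position (size l) (suc p)
... | inLeft pl = (λ h → proj₁ ih (trans (sym e) h)) , (λ h → trans e (proj₂ ih h))
  where
  e : lookupM (leafFlags true l ++ leafFlags false r) p ≡ lookupM (leafFlags true l) p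
  e = lookupM-++ˡ (leafFlags true l) _ p (subst (p <_) (sym (length-leafFlags true l)) (≤-trans pl (n≤1+n _)))
  ih : (LeftChild true l p → subtreeStart l (suc p) ≡ suc p) × (subtreeStart l (suc p) ≡ suc p → LeftChild true l p)
  ih = leftChild⇔subtreeStart true l p o pl
... | atRoot refl = (λ h → ⊥-elim (just-false≢just-true (trans (sym lastl) h))) , (λ h → ⊥-elim (1+n≰n (≤-trans (s≤s o) (≤-reflexive (sym h)))))
  where
  lastl : lookupM (leafFlags true l ++ leafFlags false r) (size l) ≡ just false
  lastl = leafFlags-lastOfLeft l r o
  just-false≢just-true : just false ≢ just true
  just-false≢just-true ()
... | inRight p' e = to , from
  where
  pe : p ≡ length (leafFlags true l) + p'
  pe = trans (suc-injective e) (trans (+-suc (size l) p') (cong (_+ p') (sym (length-leafFlags true l))))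
  e2 : lookupM (leafFlags true l ++ leafFlags false r) p ≡ lookupM (leafFlags false r) p'
  e2 = trans (cong (lookupM (leafFlags true l ++ leafFlags false r)) pe) (lookupM-++ʳ (leafFlags true l) _ p')
  p'r : p' < size r
  p'r = +-cancelˡ-≤ (size l) (suc p') (size r) (subst (_≤ size l + size r) (suc-injective e) (≤-pred q))
  sp : suc (size l) + suc p' ≡ suc p
  sp = sym e
  core : (LeftChild false r p' → subtreeStart r (suc p') ≡ suc p') × (subtreeStart r (suc p') ≡ suc p' → LeftChild false r p')
  core = leftChild⇔subtreeStart₀ r p' p'r
  to : LeftChild false (l ∨T r) p → suc (size l) + subtreeStart r (suc p') ≡ suc p
  to h = trans (cong (suc (size l) +_) (proj₁ core (trans (sym e2) h))) sp
  from : suc (size l) + subtreeStart r (suc p') ≡ suc p → LeftChild false (l ∨T r) p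
  from h = trans e2 (proj₂ core (+-cancelˡ-≡ (suc (size l)) _ _ (trans h (sym sp))))

leftChild⇔subtreeStart₀ leaf p' ()
leftChild⇔subtreeStart₀ r@(_ ∨T _) zero pr = (λ _ → ≤-antisym (subtreeStart≤ r 1 (s≤s z≤n) pr) (subtreeStart≥1 r 1)) , (λ _ → leafFlags-first r)
leftChild⇔subtreeStart₀ r (suc p'') pr = leftChild⇔subtreeStart false r (suc p'') (s≤s z≤n) pr

adjacent-outside : ∀ t p → p < size t → p < subtreeStart t (suc p) → subtreeStart t (suc p) ≡ suc p
adjacent-outside t p q outside = ≤-antisym (subtreeStart≤ t (suc p) (s≤s z≤n) q) outside

L≐Des∘gam : ∀ {n} t → size t ≡ n → L n t ≐ Des n (gam t)
L≐Des∘gam t refl p = (λ (o , pn , h) → o , pn , descent o pn h) , (λ (o , pn , dsc) → o , pn , leftChild o pn dsc)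
  where
  descent : 1 ≤ p → p < size t → LeftChild false t p → val (gam t) (suc p) < val (gam t) p
  descent o pn h = Inv⇒> (gam t) (outside⇒gam-inversion t o ≤-refl pn (≤-reflexive (sym (proj₁ (leftChild⇔subtreeStart false t p o pn) h))))
  leftChild : 1 ≤ p → p < size t → val (gam t) (suc p) < val (gam t) p → LeftChild false t p
  leftChild o pn dsc = proj₂ (leftChild⇔subtreeStart false t p o pn)
    (adjacent-outside t p pn (gam-inversion⇒outside t (o , ≤-refl , subst (suc p ≤_) (sym (length-gam t)) pn , dsc)))

L∘lam≐Des : ∀ {n σ} → IsPermᵛ n σ → L n (lam σ) ≐ Des n σ
L∘lam≐Des {n} {σ} d p = (λ (o , pn , h) → o , pn , descent o pn h) , (λ (o , pn , dsc) → o , pn , leftChild o pn dsc)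
  where
  pλ : p < n → p < size (lam σ)
  pλ pn = subst (p <_) (sym (lam-size d)) pn
  descent : 1 ≤ p → p < n → LeftChild false (lam σ) p → val σ (suc p) < val σ p
  descent o pn h = subst (λ z → val σ (suc p) < val σ (z ∸ 1)) start≡
    (proj₂ (lam-previousGreater d (suc p) (s≤s z≤n) (pλ pn)) (subst (2 ≤_) (sym start≡) (s≤s o)))
    where
    start≡ : subtreeStart (lam σ) (suc p) ≡ suc p
    start≡ = proj₁ (leftChild⇔subtreeStart false (lam σ) p o (pλ pn)) h
  leftChild : 1 ≤ p → p < n → val σ (suc p) < val σ p → LeftChild false (lam σ) p
  leftChild o pn dsc = proj₂ (leftChild⇔subtreeStart false (lam σ) p o (pλ pn))
    (adjacent-outside (lam σ) p (pλ pn) (lam-inversion⇒outside d (o , ≤-refl , subst (suc p ≤_) (sym (length≡ d)) pn , dsc)))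

GDes⇒GDesᵛ : ∀ n σ p → GDes n σ p → GDesᵛ σ n p
GDes⇒GDesᵛ n .(α ∖P β) p (o , pn , α , β , pα , pβ , refl) i m oi ip pm mn =
  subst₂ _<_ (sym vm) (sym vi) (≤-<-trans (proj₂ (bounded dβ (suc m') (s≤s z≤n) m'b)) big)
  where
  dα : IsPermᵛ p α
  dα = IsPerm⇒IsPermᵛ p α pα
  dβ : IsPermᵛ (n ∸ p) β
  dβ = IsPerm⇒IsPermᵛ (n ∸ p) β pβ
  lmap : length (map (_+ length β) α) ≡ p
  lmap = trans (length-map _ α) (length≡ dα)
  m' : ℕ
  m' = m ∸ suc p
  em : m ≡ p + suc m'
  em = sym (m+suc[n∸suc[m]]≡n p m pm)
  m'b : suc m' ≤ n ∸ p
  m'b = subst (_≤ n ∸ p) (m+n∸m≡n p (suc m')) (∸-monoˡ-≤ p (subst (_≤ n) em mn))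
  vm : val (α ∖P β) m ≡ val β (suc m')
  vm = trans (cong (val (α ∖P β)) (trans em (cong (_+ suc m') (sym lmap)))) (val-++ʳ (map (_+ length β) α) β m')
  vi : val (α ∖P β) i ≡ val α i + (n ∸ p)
  vi = trans (val-++ˡ (map (_+ length β) α) β i (subst (i ≤_) (sym lmap) ip))
    (trans (val-map (_+ length β) α i oi (subst (i ≤_) (sym (length≡ dα)) ip)) (cong (val α i +_) (length≡ dβ)))
  big : n ∸ p < val α i + (n ∸ p)
  big = +-monoˡ-≤ (n ∸ p) (proj₁ (bounded dα i oi ip))

val⇒All : ∀ (P : ℕ → Set) xs → (∀ i → 1 ≤ i → i ≤ length xs → P (val xs i)) → All P xs
val⇒All P [] H = []
val⇒All P (x ∷ xs) H = H 1 (s≤s z≤n) (s≤s z≤n) ∷ val⇒All P xs (λ { (suc i) o q → H (suc (suc i)) (s≤s z≤n) (s≤s q) })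

module TopPrefixSplit {n σ p} (d : IsPermᵛ n σ) (p<n : p < n) (high : TopPrefix n σ p) where

  private
    c : ℕ
    c = n ∸ p
    length-take-p : length (take p σ) ≡ p
    length-take-p = length-take-≤ p σ (subst (p ≤_) (sym (length≡ d)) (<⇒≤ p<n))

  α β : List ℕ
  α = map (_∸ c) (take p σ)
  β = drop p σ

  length-β : length β ≡ c
  length-β = trans (length-drop p σ) (cong (_∸ p) (length≡ d))

  σ≡α∖β : σ ≡ α ∖P β
  σ≡α∖β = begin
    σ                                                ≡⟨ take++drop≡id p σ ⟨
    take p σ ++ β                                    ≡⟨ cong (_++ β) (map-id-local restore) ⟨
    map (λ x → x ∸ c + length β) (take p σ) ++ β     ≡⟨ cong (_++ β) (map-∘ {g = _+ length β} {f = _∸ c} (take p σ)) ⟩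
    α ∖P β                                           ∎
    where
    open ≡-Reasoning
    above-c : All (c <_) (take p σ)
    above-c = val⇒All (c <_) (take p σ) λ i o q →
      subst (c <_) (sym (val-take p σ i (subst (i ≤_) length-take-p q))) (high i o (subst (i ≤_) length-take-p q))
    restore : All (λ x → x ∸ c + length β ≡ x) (take p σ)
    restore = All.map (λ c<x → trans (cong (_ +_) length-β) (m∸n+n≡m (<⇒≤ c<x))) above-c

  α-perm : IsPermᵛ p α
  α-perm = record { length≡ = trans (length-map _ (take p σ)) length-take-p ; bounded = rng ; injective = inj }
    where
    vα : ∀ i → 1 ≤ i → i ≤ p → val α i ≡ val σ i ∸ c
    vα i oi qi = trans (val-map (_∸ c) (take p σ) i oi (subst (i ≤_) (sym length-take-p) qi)) (cong (_∸ c) (val-take p σ i qi))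
    rng : MapsInto p p (val α)
    rng i oi qi = subst (λ z → 1 ≤ z × z ≤ p) (sym (vα i oi qi))
      (m+n≤o⇒m≤o∸n 1 (high i oi qi) , subst (val σ i ∸ c ≤_) (m∸[m∸n]≡n (<⇒≤ p<n)) (∸-monoˡ-≤ c (proj₂ (bounded d i oi (≤-trans qi (<⇒≤ p<n))))))
    inj : InjectiveOn p (val α)
    inj i j oi qi oj qj e = injective d i j oi (≤-trans qi (<⇒≤ p<n)) oj (≤-trans qj (<⇒≤ p<n))
      (trans (sym (m∸n+n≡m (<⇒≤ (high i oi qi)))) (trans (cong (_+ c) (trans (sym (vα i oi qi)) (trans e (vα j oj qj)))) (m∸n+n≡m (<⇒≤ (high j oj qj)))))

  β-perm : IsPermᵛ c β
  β-perm = record { length≡ = length-β ; bounded = rng ; injective = drop-injective n σ p (injective d) }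
    where
    rng : MapsInto c c (val β)
    rng (suc i') oi qi = subst (λ z → 1 ≤ z × z ≤ c) (sym (val-drop p σ i'))
      (proj₁ (bounded d (p + suc i') (≤-trans oi (m≤n+m _ p)) bd) , TopPrefix⇒suffixLow n σ p d (<⇒≤ p<n) high (p + suc i') (m<m+n p oi) bd)
      where
      bd : p + suc i' ≤ n
      bd = subst (p + suc i' ≤_) (m+[n∸m]≡n (<⇒≤ p<n)) (+-monoʳ-≤ p qi)

GDesᵛ⇒GDes : ∀ n σ p → IsPermᵛ n σ → 1 ≤ p → p < n → GDesᵛ σ n p → GDes n σ p
GDesᵛ⇒GDes n σ p d o p<n gd = o , p<n , α , β , IsPermᵛ⇒IsPerm p α α-perm , IsPermᵛ⇒IsPerm (n ∸ p) β β-perm , σ≡α∖β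
  where open TopPrefixSplit d p<n (GDesᵛ⇒TopPrefix n σ p d o p<n gd)

GDesᵛ-mono : ∀ n σ τ p → σ ≤W τ → GDesᵛ σ n p → length σ ≡ n → GDesᵛ τ n p
GDesᵛ-mono n σ τ p w gd ls i m oi ip pm mn = Inv⇒> τ (w i m (oi , ≤-<-trans ip pm , subst (m ≤_) (sym ls) mn , gd i m oi ip pm mn))

GDesᵛ-gam⇒ : ∀ {n} t p → size t ≡ n → 1 ≤ p → GDesᵛ (gam t) n p → ∀ m → p < m → m ≤ n → p < subtreeStart t m
GDesᵛ-gam⇒ t p refl o gd m pm mn = gam-inversion⇒outside t (o , pm , subst (m ≤_) (sym (length-gam t)) mn , gd p m o ≤-refl pm mn)

GDesᵛ-gam⇐ : ∀ {n} t p → size t ≡ n → (∀ m → p < m → m ≤ n → p < subtreeStart t m) → GDesᵛ (gam t) n p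
GDesᵛ-gam⇐ t p refl outside i m oi ip pm mn = Inv⇒> (gam t) (outside⇒gam-inversion t oi (≤-<-trans ip pm) mn (≤-<-trans ip (outside m pm mn)))

R-fromStarts : ∀ t p → 1 ≤ p → p < size t → (∀ m → p < m → m ≤ size t → p < subtreeStart t m) →
  Σ Tree λ r → Σ Tree λ s → (size r ≡ p) × (size s ≡ size t ∸ p) × (t ≡ r ∖T s)
R-fromStarts leaf p o () H
R-fromStarts (l ∨T r') p o q H with position (size l) p
... | inLeft pl = ⊥-elim (<⇒≱ (subst (p <_) (subtreeStart-atRoot l r') (H (suc (size l)) (s≤s pl) (s≤s (m≤m+n _ _)))) o)
... | atRoot refl = l ∨T leaf , r' , cong suc (+-identityʳ _) , sym (m+n∸m≡n (size l) (size r')) , refl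
... | inRight p' refl with R-fromStarts r' (suc p') (s≤s z≤n) q' H'
  where
  q' : suc p' < size r'
  q' = +-cancelˡ-< (size l) _ _ (≤-pred q)
  H' : ∀ m → suc p' < m → m ≤ size r' → suc p' < subtreeStart r' m
  H' (suc m3) pm mn = +-cancelˡ-< (suc (size l)) _ _ (subst (suc (size l) + suc p' <_) (subtreeStart-inRight l r' m3)
    (H (suc (size l) + suc m3) (+-monoʳ-< (suc (size l)) pm) (s≤s (+-monoʳ-≤ (size l) mn))))
...   | r1 , s , e1 , e2 , eq = l ∨T r1 , s , cong (λ z → suc (size l + z)) e1 , trans e2 (sym ([m+n]∸[m+o]≡n∸o (size l) (size r') (suc p'))) , cong (l ∨T_) eq

subtreeStart-∖T-beyond : ∀ r s m → size r < m → m ≤ size r + size s → size r < subtreeStart (r ∖T s) m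
subtreeStart-∖T-beyond r s m pm mn =
  subst (size r <_) (sym (trans (cong (subtreeStart (r ∖T s)) em) (subtreeStart-∖T-right r s (m ∸ suc (size r))))) (m<m+n (size r) (subtreeStart≥1 s _))
  where
  em : m ≡ size r + suc (m ∸ suc (size r))
  em = sym (m+suc[n∸suc[m]]≡n (size r) m pm)

R≐GDes∘gam : ∀ {n} t → size t ≡ n → R n t ≐ GDes n (gam t)
R≐GDes∘gam {n} t t-size p = to , from
  where
  to : R n t p → GDes n (gam t) p
  to (o , pn , r , s , sr , ss , refl) = GDesᵛ⇒GDes n (gam (r ∖T s)) p (gam-IsPermᵛ′ (r ∖T s) t-size) o pn (GDesᵛ-gam⇐ (r ∖T s) p t-size beyond)
    where
    beyond : ∀ m → p < m → m ≤ n → p < subtreeStart (r ∖T s) m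
    beyond m pm mn = subst (_< subtreeStart (r ∖T s) m) sr
      (subtreeStart-∖T-beyond r s m (subst (_< m) (sym sr) pm) (subst (m ≤_) (trans (sym t-size) (size-∖T r s)) mn))
  from : GDes n (gam t) p → R n t p
  from g@(o , pn , _) with R-fromStarts t p o (subst (p <_) (sym t-size) pn)
                             (λ m pm mn → GDesᵛ-gam⇒ t p t-size o (GDes⇒GDesᵛ n (gam t) p g) m pm (subst (m ≤_) t-size mn))
  ... | r , s , e1 , e2 , eq = o , pn , r , s , e1 , subst (λ z → size s ≡ z ∸ p) t-size e2 , eq

-- The maps C and Z
foldC : List ℕ → Tree
foldC = foldr (λ k acc → oneT k ∖T acc) leaf

foldZ : List ℕ → List ℕ
foldZ = foldr (λ k acc → idP k ∖P acc) []

length-∖P : ∀ B T → length (B ∖P T) ≡ length B + length T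
length-∖P B T = trans (length-++ (map (_+ length T) B)) (cong (_+ length T) (length-map _ B))

∨P-∖P : ∀ A B T → A ∨P (B ∖P T) ≡ (A ∨P B) ∖P T
∨P-∖P A B T = trans (cong₂ (λ u v → u ++ (v ∷ (map (_+ length T) B ++ T))) e1 e2)
  (sym (trans (cong (_++ T) (map-++ (_+ length T) (map (_+ length B) A) _)) (++-assoc (map (_+ length T) (map (_+ length B) A)) _ T)))
  where
  e1 : map (_+ length (B ∖P T)) A ≡ map (_+ length T) (map (_+ length B) A)
  e1 = trans (cong (λ z → map (_+ z) A) (length-∖P B T)) (trans (map-cong (λ x → sym (+-assoc x (length B) (length T))) A) (map-∘ A))
  e2 : suc (length A + length (B ∖P T)) ≡ suc (length A + length B) + length T
  e2 = cong suc (trans (cong (length A +_) (length-∖P B T)) (sym (+-assoc (length A) (length B) (length T))))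

gam-∖T : ∀ s t → gam (s ∖T t) ≡ gam s ∖P gam t
gam-∖T leaf t = refl
gam-∖T (l ∨T r) t = trans (cong (gam l ∨P_) (gam-∖T r t)) (∨P-∖P (gam l) (gam r) (gam t))

gam-oneT : ∀ k → gam (oneT k) ≡ idP k
gam-oneT zero = refl
gam-oneT (suc k) = trans (cong₂ (λ u v → u ++ (suc v ∷ [])) shifted-id top) (applyUpTo-∷ʳ suc k)
  where
  shifted-id : map (_+ 0) (gam (oneT k)) ≡ idP k
  shifted-id = trans (map-cong +-identityʳ (gam (oneT k))) (trans (map-id (gam (oneT k))) (gam-oneT k))
  top : length (gam (oneT k)) + 0 ≡ k
  top = trans (+-identityʳ _) (trans (length-gam (oneT k)) (size-oneT k))

gam-foldC : ∀ bs → gam (foldC bs) ≡ foldZ bs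
gam-foldC [] = refl
gam-foldC (k ∷ bs) = trans (gam-∖T (oneT k) (foldC bs)) (cong₂ _∖P_ (gam-oneT k) (gam-foldC bs))

gam∘C≡Z : ∀ n S → gam (C n S) ≡ Z n S
gam∘C≡Z n S = gam-foldC (blocks n S)

size-foldC : ∀ bs → size (foldC bs) ≡ sum bs
size-foldC [] = refl
size-foldC (k ∷ bs) = trans (size-∖T (oneT k) (foldC bs)) (cong₂ _+_ (size-oneT k) (size-foldC bs))

sum-blocksGo : ∀ c bs → sum (blocksGo c bs) ≡ c + length bs
sum-blocksGo c [] = refl
sum-blocksGo c (true ∷ bs) = cong (c +_) (sum-blocksGo 1 bs)
sum-blocksGo c (false ∷ bs) = trans (sum-blocksGo (suc c) bs) (sym (+-suc c (length bs)))

sum-blocks : ∀ n S → sum (blocks n S) ≡ n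
sum-blocks zero S = refl
sum-blocks (suc m) S = trans (sum-blocksGo 1 (toList S)) (cong suc (length-toList S))

size-C : ∀ n S → size (C n S) ≡ n
size-C n S = trans (size-foldC (blocks n S)) (sum-blocks n S)

length-Z : ∀ n S → length (Z n S) ≡ n
length-Z n S = trans (cong length (sym (gam∘C≡Z n S))) (trans (length-gam (C n S)) (size-C n S))

Z-IsPermᵛ : ∀ n S → IsPermᵛ n (Z n S)
Z-IsPermᵛ n S = subst (IsPermᵛ n) (gam∘C≡Z n S) (gam-IsPermᵛ′ (C n S) (size-C n S))

PartialSum : List ℕ → ℕ → Set
PartialSum [] p = ⊥
PartialSum (k ∷ bs) p = (p ≡ k) ⊎ Σ ℕ λ p' → PartialSum bs p' × (p ≡ k + p')

subtreeStart-oneT∖T-left : ∀ k A j → j ≤ k → subtreeStart (oneT k ∖T A) j ≡ 1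
subtreeStart-oneT∖T-left k A j q = trans (subtreeStart-∖T-left (oneT k) A j (subst (j ≤_) (sym (size-oneT k)) q)) (subtreeStart-oneT k j q)

subtreeStart-oneT∖T-right : ∀ k A j' → subtreeStart (oneT k ∖T A) (k + suc j') ≡ k + subtreeStart A (suc j')
subtreeStart-oneT∖T-right k A j' =
  subst (λ z → subtreeStart (oneT k ∖T A) (z + suc j') ≡ z + subtreeStart A (suc j')) (size-oneT k) (subtreeStart-∖T-right (oneT k) A j')

PartialSumBetween : List ℕ → ℕ → ℕ → Set
PartialSumBetween bs i j = Σ ℕ λ p → PartialSum bs p × i ≤ p × p < j

subtreeStart-foldC : ∀ bs i j → 1 ≤ i → i < j → j ≤ sum bs →
  (i < subtreeStart (foldC bs) j → PartialSumBetween bs i j) × (PartialSumBetween bs i j → i < subtreeStart (foldC bs) j)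
subtreeStart-foldC [] i j o ij jn = ⊥-elim (n≮0 (≤-trans (≤-trans (s≤s z≤n) (≤-trans o (<⇒≤ ij))) jn))
subtreeStart-foldC (k ∷ bs) i j o ij jn with split k j
... | before jk = (λ h → ⊥-elim (<⇒≱ (subst (i <_) (subtreeStart-oneT∖T-left k (foldC bs) j jk) h) o))
                , (λ { (p , inj₁ refl , ip , pj) → ⊥-elim (<⇒≱ pj jk)
                     ; (p , inj₂ (p' , _ , refl) , ip , pj) → ⊥-elim (<⇒≱ pj (≤-trans jk (m≤m+n k p'))) })
... | after j' refl with i ≤? k
...   | yes ik = (λ _ → k , inj₁ refl , ik , m<m+n k (s≤s z≤n))
               , (λ _ → subst (i <_) (sym (subtreeStart-oneT∖T-right k (foldC bs) j')) (≤-<-trans ik (m<m+n k (subtreeStart≥1 (foldC bs) (suc j')))))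
...   | no nik = to , from
  where
  i' : ℕ
  i' = i ∸ suc k
  ei : i ≡ k + suc i'
  ei = sym (m+suc[n∸suc[m]]≡n k i (≰⇒> nik))
  ij' : suc i' < suc j'
  ij' = +-cancelˡ-< k _ _ (subst (_< k + suc j') ei ij)
  ih : (suc i' < subtreeStart (foldC bs) (suc j') → PartialSumBetween bs (suc i') (suc j'))
     × (PartialSumBetween bs (suc i') (suc j') → suc i' < subtreeStart (foldC bs) (suc j'))
  ih = subtreeStart-foldC bs (suc i') (suc j') (s≤s z≤n) ij' (+-cancelˡ-≤ k _ _ jn)
  to : i < subtreeStart (foldC (k ∷ bs)) (k + suc j') → PartialSumBetween (k ∷ bs) i (k + suc j')
  to h with proj₁ ih (+-cancelˡ-< k _ _ (subst₂ _<_ ei (subtreeStart-oneT∖T-right k (foldC bs) j') h))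
  ... | p' , c' , ip , pj = k + p' , inj₂ (p' , c' , refl) , subst (_≤ k + p') (sym ei) (+-monoʳ-≤ k ip) , +-monoʳ-< k pj
  from : PartialSumBetween (k ∷ bs) i (k + suc j') → i < subtreeStart (foldC (k ∷ bs)) (k + suc j')
  from (p , inj₁ refl , ip , pj) = ⊥-elim (nik ip)
  from (p , inj₂ (p' , c' , refl) , ip , pj) = subst₂ _<_ (sym ei) (sym (subtreeStart-oneT∖T-right k (foldC bs) j'))
    (+-monoʳ-< k (proj₂ ih (p' , c' , +-cancelˡ-≤ k _ _ (subst (_≤ k + p') ei ip) , +-cancelˡ-< k _ _ pj)))

-- The partial sums of blocksGo c bs are c plus the positions of true in bs, and c + length bs.
ShiftedCut : ∀ {m'} → ℕ → Vec Bool m' → ℕ → Set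
ShiftedCut {m'} c S p = (p ≡ c + m') ⊎ Σ (Fin m') λ i → (i FS.∈ S) × (p ≡ c + toℕ i)

partialSum-blocksGo : ∀ {m'} c (S : Vec Bool m') p →
  (PartialSum (blocksGo c (toList S)) p → ShiftedCut c S p) × (ShiftedCut c S p → PartialSum (blocksGo c (toList S)) p)
partialSum-blocksGo c [] p = (λ { (inj₁ e) → inj₁ (trans e (sym (+-identityʳ c))) ; (inj₂ (_ , () , _)) })
                           , (λ { (inj₁ e) → inj₁ (trans e (+-identityʳ c)) ; (inj₂ (() , _)) })
partialSum-blocksGo {suc m''} c (true ∷ S) p = to , from
  where
  to : PartialSum (c ∷ blocksGo 1 (toList S)) p → ShiftedCut c (true ∷ S) p
  to (inj₁ e) = inj₂ (zero , here , trans e (sym (+-identityʳ c)))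
  to (inj₂ (p' , cp' , e)) with proj₁ (partialSum-blocksGo 1 S p') cp'
  ... | inj₁ e' = inj₁ (trans e (cong (c +_) e'))
  ... | inj₂ (i , h , e') = inj₂ (suc i , there h , trans e (cong (c +_) e'))
  from : ShiftedCut c (true ∷ S) p → PartialSum (c ∷ blocksGo 1 (toList S)) p
  from (inj₁ e) = inj₂ (suc m'' , proj₂ (partialSum-blocksGo 1 S (suc m'')) (inj₁ refl) , e)
  from (inj₂ (zero , here , e)) = inj₁ (trans e (+-identityʳ c))
  from (inj₂ (suc i , there h , e)) = inj₂ (suc (toℕ i) , proj₂ (partialSum-blocksGo 1 S (suc (toℕ i))) (inj₂ (i , h , refl)) , e)
partialSum-blocksGo {suc m''} c (false ∷ S) p = to , from
  where
  to : PartialSum (blocksGo (suc c) (toList S)) p → ShiftedCut c (false ∷ S) p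
  to cp with proj₁ (partialSum-blocksGo (suc c) S p) cp
  ... | inj₁ e = inj₁ (trans e (sym (+-suc c m'')))
  ... | inj₂ (i , h , e) = inj₂ (suc i , there h , trans e (sym (+-suc c _)))
  from : ShiftedCut c (false ∷ S) p → PartialSum (blocksGo (suc c) (toList S)) p
  from (inj₁ e) = proj₂ (partialSum-blocksGo (suc c) S p) (inj₁ (trans e (+-suc c m'')))
  from (inj₂ (zero , () , e))
  from (inj₂ (suc i , there h , e)) = proj₂ (partialSum-blocksGo (suc c) S p) (inj₂ (i , h , trans e (+-suc c _)))

memQ⇒partialSum : ∀ m S p → memQ (suc m) p S → PartialSum (blocks (suc m) S) p
memQ⇒partialSum m S p (i , e , h) = proj₂ (partialSum-blocksGo 1 S p) (inj₂ (i , h , sym e))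

partialSum⇒memQ : ∀ m S p → PartialSum (blocks (suc m) S) p → p < suc m → memQ (suc m) p S
partialSum⇒memQ m S p c pm with proj₁ (partialSum-blocksGo 1 S p) c
... | inj₁ e = ⊥-elim (<-irrefl e pm)
... | inj₂ (i , h , e) = i , sym e , h

memQ-bounds : ∀ n p S → memQ n p S → (1 ≤ p) × (p < n)
memQ-bounds (suc m) p S (i , e , h) = subst (1 ≤_) e (s≤s z≤n) , subst (_< suc m) e (s≤s (toℕ<n i))

memQ-mono : ∀ n {p} {S T : Subset (n ∸ 1)} → S ⊆ T → memQ n p S → memQ n p T
memQ-mono n S⊆T (i , e , i∈S) = i , e , S⊆T i∈S

Separates : (n : ℕ) → Subset (n ∸ 1) → ℕ → ℕ → Set
Separates n S i j = Σ ℕ λ p → memQ n p S × i ≤ p × p < j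

Z-inversion : ∀ n S {i j} → 1 ≤ i → i < j → j ≤ n → (val (Z n S) j < val (Z n S) i) ⇔ Separates n S i j
Z-inversion zero S o ij jn = ⊥-elim (n≮0 (≤-trans (≤-trans (s≤s z≤n) (≤-trans o (<⇒≤ ij))) jn))
Z-inversion (suc m) S {i} {j} o ij jn = mk⇔ to from
  where
  CS : Tree
  CS = C (suc m) S
  jT : j ≤ size CS
  jT = subst (j ≤_) (sym (size-C (suc m) S)) jn
  starts : (i < subtreeStart CS j → PartialSumBetween (blocks (suc m) S) i j) × (PartialSumBetween (blocks (suc m) S) i j → i < subtreeStart CS j)
  starts = subtreeStart-foldC (blocks (suc m) S) i j o ij (subst (j ≤_) (sym (sum-blocks (suc m) S)) jn)
  to : val (Z (suc m) S) j < val (Z (suc m) S) i → Separates (suc m) S i j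
  to h with proj₁ starts (gam-inversion⇒outside CS (outside⇒gam-inversion′ h))
    where
    outside⇒gam-inversion′ : val (Z (suc m) S) j < val (Z (suc m) S) i → Inv (gam CS) i j
    outside⇒gam-inversion′ h = o , ij , subst (j ≤_) (sym (length-gam CS)) jT , subst (λ z → val z j < val z i) (sym (gam∘C≡Z (suc m) S)) h
  ... | p , c , ip , pj = p , partialSum⇒memQ m S p c (<-≤-trans pj jn) , ip , pj
  from : Separates (suc m) S i j → val (Z (suc m) S) j < val (Z (suc m) S) i
  from (p , mq , ip , pj) = subst (λ z → val z j < val z i) (gam∘C≡Z (suc m) S)
    (Inv⇒> (gam CS) (outside⇒gam-inversion CS o ij jT (proj₂ starts (p , memQ⇒partialSum m S p mq , ip , pj))))

≤W-trans : ∀ {σ τ υ} → σ ≤W τ → τ ≤W υ → σ ≤W υ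
≤W-trans a b i j x = b i j (a i j x)

descent-between : ∀ σ i j → i < j → val σ j < val σ i → Σ ℕ λ p → i ≤ p × p < j × val σ (suc p) < val σ p
descent-between σ i (suc j') (s≤s ij') lt with val σ (suc j') <? val σ j'
... | yes h = j' , ij' , ≤-refl , h
... | no h with m≤n⇒m<n∨m≡n ij'
...   | inj₁ i<j' with descent-between σ i j' i<j' (≤-<-trans (≮⇒≥ h) lt)
...     | p , ip , pj , d = p , ip , ≤-trans pj (n≤1+n _) , d
descent-between σ i (suc j') (s≤s ij') lt | no h | inj₂ refl = ⊥-elim (h lt)

Des⊣Z : ∀ {n} σ S → length σ ≡ n → inclPQ n (Des n σ) S ⇔ (σ ≤W Z n S)
Des⊣Z {n} σ S σ-length = mk⇔ to from
  where
  to : inclPQ n (Des n σ) S → σ ≤W Z n S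
  to Des⊆S i j (o , ij , jl , lt) with descent-between σ i j ij lt
  ... | p , ip , pj , d = o , ij , subst (j ≤_) (sym (length-Z n S)) jn ,
                          Equivalence.from (Z-inversion n S o ij jn) (p , Des⊆S p (≤-trans o ip , <-≤-trans pj jn , d) , ip , pj)
    where
    jn : j ≤ n
    jn = subst (j ≤_) σ-length jl
  from : σ ≤W Z n S → inclPQ n (Des n σ) S
  from w p (o , pn , d) with Equivalence.to (Z-inversion n S o ≤-refl pn) (Inv⇒> (Z n S) (w p (suc p) (o , ≤-refl , subst (suc p ≤_) (sym σ-length) pn , d)))
  ... | q , mq , pq , qp = subst (λ z → memQ n z S) (≤-antisym (≤-pred qp) pq) mq

Z⊣GDes : ∀ {n σ} S → IsPermᵛ n σ → (Z n S ≤W σ) ⇔ inclQP n S (GDes n σ)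
Z⊣GDes {n} {σ} S d = mk⇔ to from
  where
  to : Z n S ≤W σ → inclQP n S (GDes n σ)
  to w p mq = GDesᵛ⇒GDes n σ p d (proj₁ (memQ-bounds n p S mq)) (proj₂ (memQ-bounds n p S mq)) gd
    where
    gd : GDesᵛ σ n p
    gd i m oi ip pm mn = Inv⇒> σ (w i m (oi , ≤-<-trans ip pm , subst (m ≤_) (sym (length-Z n S)) mn ,
                                  Equivalence.from (Z-inversion n S oi (≤-<-trans ip pm) mn) (p , mq , ip , pm)))
  from : inclQP n S (GDes n σ) → Z n S ≤W σ
  from S⊆GDes i j (o , ij , jl , lt) with Equivalence.to (Z-inversion n S o ij (subst (j ≤_) (length-Z n S) jl)) lt
  ... | p , mq , ip , pj = o , ij , subst (j ≤_) (sym (length≡ d)) jn , GDes⇒GDesᵛ n σ p (S⊆GDes p mq) i j o ip pj jn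
    where
    jn : j ≤ n
    jn = subst (j ≤_) (length-Z n S) jl

Des-mono : ∀ n σ τ → σ ≤W τ → length σ ≡ n → Des n σ ⊆P Des n τ
Des-mono n σ τ w σ-length p (o , pn , d) = o , pn , Inv⇒> τ (w p (suc p) (o , ≤-refl , subst (suc p ≤_) (sym σ-length) pn , d))

GDes-mono : ∀ n σ τ → IsPermᵛ n σ → IsPermᵛ n τ → σ ≤W τ → GDes n σ ⊆P GDes n τ
GDes-mono n σ τ dσ dτ w p g@(o , pn , _) = GDesᵛ⇒GDes n τ p dτ o pn (GDesᵛ-mono n σ τ p w (GDes⇒GDesᵛ n σ p g) (length≡ dσ))

-- L = Des ∘ gam and gam ∘ C = Z, and gam is an order embedding; so L ⊣ C follows from Des ⊣ Z.
L⊣C : ∀ {n} t S → size t ≡ n → inclPQ n (L n t) S ⇔ (t ≤T C n S)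
L⊣C {n} t S t-size = mk⇔ to from
  where
  gam-length : length (gam t) ≡ n
  gam-length = trans (length-gam t) t-size
  to : inclPQ n (L n t) S → t ≤T C n S
  to L⊆S = gam-reflects-≤ t (C n S) (trans t-size (sym (size-C n S))) (subst (gam t ≤W_) (sym (gam∘C≡Z n S))
    (Equivalence.to (Des⊣Z (gam t) S gam-length) (λ p Dp → L⊆S p (proj₂ (L≐Des∘gam t t-size p) Dp))))
  from : t ≤T C n S → inclPQ n (L n t) S
  from t≤C p Lp = Equivalence.from (Des⊣Z (gam t) S gam-length) (subst (gam t ≤W_) (gam∘C≡Z n S) (gam-mono t≤C)) p (proj₁ (L≐Des∘gam t t-size p) Lp)

C⊣R : ∀ {n} t S → size t ≡ n → (C n S ≤T t) ⇔ inclQP n S (R n t)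
C⊣R {n} t S t-size = mk⇔ to from
  where
  to : C n S ≤T t → inclQP n S (R n t)
  to C≤t p mq = proj₂ (R≐GDes∘gam t t-size p)
    (Equivalence.to (Z⊣GDes S (gam-IsPermᵛ′ t t-size)) (subst (_≤W gam t) (gam∘C≡Z n S) (gam-mono C≤t)) p mq)
  from : inclQP n S (R n t) → C n S ≤T t
  from S⊆R = gam-reflects-≤ (C n S) t (trans (size-C n S) (sym t-size)) (subst (_≤W gam t) (sym (gam∘C≡Z n S))
    (Equivalence.from (Z⊣GDes S (gam-IsPermᵛ′ t t-size)) (λ p mq → proj₁ (R≐GDes∘gam t t-size p) (S⊆R p mq))))

R-mono : ∀ {n s t} → size s ≡ n → size t ≡ n → s ≤T t → R n s ⊆P R n t
R-mono {n} {s} {t} s-size t-size s≤t p Rs = proj₂ (R≐GDes∘gam t t-size p)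
  (GDes-mono n (gam s) (gam t) (gam-IsPermᵛ′ s s-size) (gam-IsPermᵛ′ t t-size) (gam-mono s≤t) p (proj₁ (R≐GDes∘gam s s-size p) Rs))

L-mono : ∀ {n s t} → size s ≡ n → size t ≡ n → s ≤T t → L n s ⊆P L n t
L-mono {n} {s} {t} s-size t-size s≤t p Ls = proj₂ (L≐Des∘gam t t-size p)
  (Des-mono n (gam s) (gam t) (gam-mono s≤t) (trans (length-gam s) s-size) p (proj₁ (L≐Des∘gam s s-size p) Ls))

lam-mono : ∀ {n σ τ} → IsPermᵛ n σ → IsPermᵛ n τ → σ ≤W τ → lam σ ≤T lam τ
lam-mono {σ = σ} {τ = τ} dσ dτ σ≤τ = Equivalence.from (lam⊣gam (lam τ) dσ (lam-size dτ))
  (≤W-trans {σ} {τ} {gam (lam τ)} σ≤τ (Equivalence.to (lam⊣gam (lam τ) dτ (lam-size dτ)) ε))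

rho-mono : ∀ {n σ τ} → IsPermᵛ n σ → IsPermᵛ n τ → σ ≤W τ → rho σ ≤T rho τ
rho-mono {σ = σ} {τ = τ} dσ dτ σ≤τ = Equivalence.to (gam⊣rho (rho σ) dτ (rho-size dσ))
  (≤W-trans {gam (rho σ)} {σ} {τ} (Equivalence.from (gam⊣rho (rho σ) dσ (rho-size dσ)) ε) σ≤τ)

C-mono : ∀ n (S T : Subset (n ∸ 1)) → S ⊆ T → C n S ≤T C n T
C-mono n S T S⊆T = Equivalence.to (L⊣C (C n S) T (size-C n S))
  (λ p Lp → memQ-mono n S⊆T (Equivalence.from (L⊣C (C n S) S (size-C n S)) ε p Lp))

Z-mono : ∀ n (S T : Subset (n ∸ 1)) → S ⊆ T → Z n S ≤W Z n T
Z-mono n S T S⊆T = Equivalence.to (Des⊣Z (Z n S) T (length-Z n S))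
  (λ p Dp → memQ-mono n S⊆T (Equivalence.from (Des⊣Z (Z n S) S (length-Z n S)) (λ i j inv → inv) p Dp))

-- GDes σ ⊆ R (rho σ) runs through the connections for the singleton {p}: Z {p} ≤ σ, so C {p} ≤ rho σ.
R∘rho≐GDes : ∀ {n σ} → IsPermᵛ n σ → R n (rho σ) ≐ GDes n σ
R∘rho≐GDes {n} {σ} d p = to , from
  where
  ρσ-size : size (rho σ) ≡ n
  ρσ-size = rho-size d
  to : R n (rho σ) p → GDes n σ p
  to Rp = GDes-mono n (gam (rho σ)) σ (gam-IsPermᵛ′ (rho σ) ρσ-size) d (Equivalence.from (gam⊣rho (rho σ) d ρσ-size) ε) p
    (proj₁ (R≐GDes∘gam (rho σ) ρσ-size p) Rp)
  from : GDes n σ p → R n (rho σ) p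
  from g@(o , p<n , _) = Equivalence.to (C⊣R (rho σ) ⁅ i ⁆ ρσ-size) C≤ρσ p (i , i+1≡p , x∈⁅x⁆ i)
    where
    i : Fin (n ∸ 1)
    i = fromℕ< (∸-monoˡ-< p<n o)
    i+1≡p : suc (toℕ i) ≡ p
    i+1≡p = trans (cong suc (toℕ-fromℕ< _)) (suc[n∸1]≡n o)
    only-p : inclQP n ⁅ i ⁆ (GDes n σ)
    only-p q (k , k+1≡q , k∈) = subst (GDes n σ) (trans (sym i+1≡p) (trans (cong (λ x → suc (toℕ x)) (sym (x∈⁅y⁆⇒x≡y i k∈))) k+1≡q)) g
    C≤ρσ : C n ⁅ i ⁆ ≤T rho σ
    C≤ρσ = Equivalence.to (gam⊣rho (C n ⁅ i ⁆) d (size-C n ⁅ i ⁆)) (subst (_≤W σ) (sym (gam∘C≡Z n ⁅ i ⁆)) (Equivalence.from (Z⊣GDes ⁅ i ⁆ d) only-p))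

theorem2p1 : (n : ℕ) →
  -- the maps are well defined: λ, ρ : 𝔖_n → 𝒴_n ; γ : 𝒴_n → 𝔖_n ; C : 𝒬_n → 𝒴_n ; Z : 𝒬_n → 𝔖_n
  ((σ : List ℕ) → IsPerm n σ → size (lam σ) ≡ n × size (rho σ) ≡ n)
  × ((t : Tree) → size t ≡ n → IsPerm n (gam t))
  × ((S : Subset (n ∸ 1)) → size (C n S) ≡ n × IsPerm n (Z n S))
  -- order preservation of λ, ρ, Des, GDes
  × ((σ τ : List ℕ) → IsPerm n σ → IsPerm n τ → σ ≤W τ →
       (lam σ ≤T lam τ) × (rho σ ≤T rho τ)
       × (Des n σ ⊆P Des n τ) × (GDes n σ ⊆P GDes n τ))
  -- order preservation of γ, L, R
  × ((s t : Tree) → size s ≡ n → size t ≡ n → s ≤T t →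
       (gam s ≤W gam t) × (L n s ⊆P L n t) × (R n s ⊆P R n t))
  -- order preservation of C, Z
  × ((S T : Subset (n ∸ 1)) → S ⊆ T → (C n S ≤T C n T) × (Z n S ≤W Z n T))
  -- L ∘ λ = Des , γ ∘ C = Z , R ∘ ρ = GDes
  × ((σ : List ℕ) → IsPerm n σ → (L n (lam σ) ≐ Des n σ) × (R n (rho σ) ≐ GDes n σ))
  × ((S : Subset (n ∸ 1)) → gam (C n S) ≡ Z n S)
  -- the six Galois connections
  × ((σ : List ℕ) (t : Tree) (S : Subset (n ∸ 1)) → IsPerm n σ → size t ≡ n →
       ((lam σ ≤T t) ⇔ (σ ≤W gam t))
       × (inclPQ n (L n t) S ⇔ (t ≤T C n S))
       × (inclPQ n (Des n σ) S ⇔ (σ ≤W Z n S))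
       × ((gam t ≤W σ) ⇔ (t ≤T rho σ))
       × ((C n S ≤T t) ⇔ inclQP n S (R n t))
       × ((Z n S ≤W σ) ⇔ inclQP n S (GDes n σ)))

theorem2p1 n =
    (λ σ p → lam-size (perm p) , rho-size (perm p))
  , (λ t t-size → IsPermᵛ⇒IsPerm n (gam t) (gam-IsPermᵛ′ t t-size))
  , (λ S → size-C n S , IsPermᵛ⇒IsPerm n (Z n S) (Z-IsPermᵛ n S))
  , (λ σ τ pσ pτ σ≤τ → lam-mono (perm pσ) (perm pτ) σ≤τ , rho-mono (perm pσ) (perm pτ) σ≤τ
                     , Des-mono n σ τ σ≤τ (length≡ (perm pσ)) , GDes-mono n σ τ (perm pσ) (perm pτ) σ≤τ)
  , (λ s t s-size t-size s≤t → gam-mono s≤t , L-mono s-size t-size s≤t , R-mono s-size t-size s≤t)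
  , (λ S T S⊆T → C-mono n S T S⊆T , Z-mono n S T S⊆T)
  , (λ σ p → L∘lam≐Des (perm p) , R∘rho≐GDes (perm p))
  , gam∘C≡Z n
  , λ σ t S p t-size → lam⊣gam t (perm p) t-size , L⊣C t S t-size , Des⊣Z σ S (length≡ (perm p))
                     , gam⊣rho t (perm p) t-size , C⊣R t S t-size , Z⊣GDes S (perm p)
  where
  perm : ∀ {σ} → IsPerm n σ → IsPermᵛ n σ
  perm = IsPerm⇒IsPermᵛ n _
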